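{- Let $M\rightarrow M'$ be a matroid perspective on a finite linearly ordered set $E$. Then, as polynomials in $x,u,y,v,z$, $$t(M,M';x+u,y+v,z)=\sum_{A\subseteq E}x^{\iota_{M'}(A)}u^{cr_{M'}(A)}y^{\epsilon_M(A)}v^{nl_M(A)}z^{rcd_{M,M'}(A)}.$$
   Context: A matroid perspective $M\rightarrow M'$ is a pair of matroids $M,M'$ on the same finite set $E$ such that every circuit of $M$ is a union of circuits of $M'$. For a matroid $N$ on $E$ with rank function $r_N$, $r(N)=r_N(E)$, and $A\subseteq E$: $cr_N(A)=r(N)-r_N(A)$, $nl_N(A)=|A|-r_N(A)$; $\epsilon_N(A)$ is the number of $e\in E\setminus A$ that are the smallest element of some circuit of $N$ contained in $A\cup\{e\}$; $\iota_N(A)$ is the number of $e\in A$ that are the smallest element of some cocircuit of $N$ contained in $(E\setminus A)\cup\{e\}$. $rcd_{M,M'}(A)=r(M)-r(M')-(r_M(A)-r_{M'}(A))$, and $t(M,M';x,y,z)=\sum_{A\subseteq E}(x-1)^{r(M')-r_{M'}(A)}(y-1)^{|A|-r_M(A)}z^{rcd_{M,M'}(A)}$. -}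

module Defs where

open import Data.Nat as ℕ using (ℕ; zero; suc; _+_; _∸_; _≤_; _<_; _≟_)
import Data.Nat.Properties as ℕP
open import Data.Fin using (Fin)
import Data.Fin as F
import Data.Fin.Properties as FP
open import Data.Fin.Subset
open import Data.Fin.Subset.Properties using (_∈?_; _⊆?_; _⊂?_; anySubset?)
open import Data.Vec using (Vec; []; _∷_; tabulate)
open import Data.Product using (Σ; ∃; _×_; _,_)
open import Data.Integer as ℤ using (ℤ)
open import Relation.Nullary using (Dec; yes; no; ¬_; does)
open import Relation.Nullary.Decidable using (_×-dec_; _→-dec_; ¬?; decidable-stable)
open import Relation.Unary using (Decidable)
open import Relation.Binary.PropositionalEquality using (_≡_)

-- Ground set E = Fin n, linearly ordered by the usual order on Fin n.
-- Subsets of E are Data.Fin.Subset.Subset n; cardinality is ∣_∣.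

record Matroid (n : ℕ) : Set where
  field
    rank      : Subset n → ℕ
    rank-card : ∀ A → rank A ≤ ∣ A ∣
    rank-mono : ∀ A B → A ⊆ B → rank A ≤ rank B
    rank-submod : ∀ A B → rank (A ∪ B) + rank (A ∩ B) ≤ rank A + rank B

open Matroid public

module _ {n : ℕ} where

  totalRank : Matroid n → ℕ
  totalRank N = rank N ⊤

  Circuit : (Subset n → ℕ) → Subset n → Set
  Circuit r C = (r C < ∣ C ∣) × (∀ D → D ⊂ C → r D ≡ ∣ D ∣)

  dualRank : (Subset n → ℕ) → Subset n → ℕ
  dualRank r A = (∣ A ∣ + r (∁ A)) ∸ r ⊤

  Cocircuit : (Subset n → ℕ) → Subset n → Set
  Cocircuit r = Circuit (dualRank r)

  IsMin : Fin n → Subset n → Set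
  IsMin e C = e ∈ C × (∀ f → f ∈ C → e F.≤ f)

  ExtActive : Matroid n → Subset n → Fin n → Set
  ExtActive N A e = (¬ e ∈ A) ×
    ∃ (λ C → Circuit (rank N) C × C ⊆ (A ∪ ⁅ e ⁆) × IsMin e C)

  IntActive : Matroid n → Subset n → Fin n → Set
  IntActive N A e = (e ∈ A) ×
    ∃ (λ D → Cocircuit (rank N) D × D ⊆ (∁ A ∪ ⁅ e ⁆) × IsMin e D)

  allSub? : {P : Subset n → Set} → Decidable P → Dec (∀ D → P D)
  allSub? P? with anySubset? (λ D → ¬? (P? D))
  ... | yes (D , ¬p) = no (λ all → ¬p (all D))
  ... | no ¬ex = yes (λ D → decidable-stable (P? D) (λ ¬p → ¬ex (D , ¬p)))

  circuit? : (r : Subset n → ℕ) → Decidable (Circuit r)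
  circuit? r C = (suc (r C) ℕ.≤? ∣ C ∣) ×-dec allSub? (λ D → (D ⊂? C) →-dec (r D ≟ ∣ D ∣))

  isMin? : ∀ e C → Dec (IsMin e C)
  isMin? e C = (e ∈? C) ×-dec FP.all? (λ f → (f ∈? C) →-dec (e FP.≤? f))

  extActive? : ∀ N A → Decidable (ExtActive N A)
  extActive? N A e = ¬? (e ∈? A) ×-dec
    anySubset? (λ C → circuit? (rank N) C ×-dec ((C ⊆? (A ∪ ⁅ e ⁆)) ×-dec isMin? e C))

  intActive? : ∀ N A → Decidable (IntActive N A)
  intActive? N A e = (e ∈? A) ×-dec
    anySubset? (λ D → circuit? (dualRank (rank N)) D ×-dec ((D ⊆? (∁ A ∪ ⁅ e ⁆)) ×-dec isMin? e D))

  count : {P : Fin n → Set} → Decidable P → ℕ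
  count P? = ∣ tabulate (λ e → does (P? e)) ∣

  ε : Matroid n → Subset n → ℕ
  ε N A = count (extActive? N A)

  ι : Matroid n → Subset n → ℕ
  ι N A = count (intActive? N A)

  cr : Matroid n → Subset n → ℕ
  cr N A = totalRank N ∸ rank N A

  nl : Matroid n → Subset n → ℕ
  nl N A = ∣ A ∣ ∸ rank N A

  -- rcd_{M,M'}(A) = r(M) − r(M') − (r_M(A) − r_{M'}(A)), nonnegative for perspectives
  rcd : Matroid n → Matroid n → Subset n → ℕ
  rcd M M' A = (totalRank M + rank M' A) ∸ (totalRank M' + rank M A)

  -- matroid perspective M → M': every circuit of M is a union of circuits of M'
  Perspective : Matroid n → Matroid n → Set
  Perspective M M' = ∀ C → Circuit (rank M) C →
    ∀ e → e ∈ C → ∃ (λ C' → Circuit (rank M') C' × C' ⊆ C × e ∈ C')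

sumSubsets : (n : ℕ) → (Subset n → ℤ) → ℤ
sumSubsets zero f = f []
sumSubsets (suc n) f = sumSubsets n (λ A → f (inside ∷ A)) ℤ.+ sumSubsets n (λ A → f (outside ∷ A))

-- Tutte polynomial of the perspective, evaluated at integers
tutte : {n : ℕ} → Matroid n → Matroid n → ℤ → ℤ → ℤ → ℤ
tutte {n} M M' x y z = sumSubsets n (λ A →
  ((x ℤ.- ℤ.1ℤ) ℤ.^ cr M' A) ℤ.* (((y ℤ.- ℤ.1ℤ) ℤ.^ nl M A) ℤ.* (z ℤ.^ rcd M M' A)))

module Submission where

-- A perspective is first shown to be a quotient (r_M' grows at most as fast as r_M along
-- inclusions); the identity is then proved for quotients by induction on the size of the
-- ground set, splitting off its largest element ℓ.  Let ρ = r_M({ℓ}) (0 iff ℓ is a loop of M)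
-- and δ = r(M) − r(M∖ℓ), δ' = r(M') − r(M'∖ℓ) (1 iff ℓ is a coloop).  Splitting the sums over
-- A ⊆ E by whether ℓ ∈ A, both sides satisfy recurrences in the minors M∖ℓ, M/ℓ, M'∖ℓ, M'/ℓ:
--   T = b^(1-ρ) T(/ℓ) + a^δ' z^(δ-δ') T(∖ℓ)                  (a = x+u-1, b = y+v-1)
--   S = x^δ' v^(1-ρ) S(/ℓ) + u^δ' y^(1-ρ) z^(δ-δ') S(∖ℓ).
-- For the activity exponents this needs: the activities of the other elements do not see ℓ
-- (an element is only compared with larger ones), and ℓ itself is externally active iff it
-- is a loop and internally active iff it is a coloop.  Both facts come from
-- characterisations of the activities by ranks (internal activity through the dual matroid).
-- The quotient property forces δ' ≤ δ ≤ 1 and makes loops of M loops of M'; in the three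
-- remaining cases (loop; coloop of M'; neither) the recurrences agree by the induction
-- hypothesis, using M/ℓ = M∖ℓ for loops and coloops.

open import Defs

module Proof where

  open import Data.Nat as ℕ using (ℕ; zero; suc; _+_; _∸_; _≤_; _<_; s≤s)
  import Data.Nat.Properties as NP
  open import Data.Nat.Tactic.RingSolver using (solve-∀)
  open import Data.Fin as F using (Fin; zero; suc; inject₁; fromℕ; toℕ)
  import Data.Fin.Properties as FP
  open import Data.Fin.Subset
  open import Data.Fin.Subset.Properties
  open import Data.Vec using (Vec; []; _∷_; _∷ʳ_; tabulate; replicate; zipWith; here; there)
  import Data.Vec.Properties as VP
  open import Data.Bool using (Bool; true; false; _∨_; _∧_; not)
  import Data.Bool.Properties as BP
  open import Data.Integer as Int using (ℤ)
  import Data.Integer.Properties as ℤP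
  import Data.Integer.Tactic.RingSolver as ℤSolver
  open import Data.Product using (∃; _×_; _,_; proj₁; proj₂)
  open import Data.Sum using (_⊎_; inj₁; inj₂)
  open import Data.Empty using (⊥-elim)
  open import Function using (_∘_)
  open import Function.Bundles using (_⇔_; mk⇔; Equivalence)
  import Function.Properties.Equivalence as ⇔
  open import Relation.Nullary using (Dec; yes; no; does)
  open import Relation.Unary using (Decidable)
  open import Relation.Nullary.Decidable using (_×-dec_; does-⇔; dec-true; dec-false)
  open import Relation.Binary.PropositionalEquality

  open Equivalence using (to; from)

  private variable
    n : ℕ

  <-by-cancel : ∀ {a b c d} → a + b ≤ c + d → d < a → b < c
  <-by-cancel {a} {b} {c} {d} h d<a = NP.+-cancelˡ-< a b c
    (NP.≤-<-trans h (subst (c + d <_) (NP.+-comm c a) (NP.+-monoʳ-< c d<a)))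

  rank-step : ∀ {x y} → x ≤ suc y → y ≤ x → x ≢ y → x ≡ suc y
  rank-step x≤1+y y≤x x≢y with NP.m≤n⇒m<n∨m≡n x≤1+y
  ... | inj₂ x≡1+y = x≡1+y
  ... | inj₁ (s≤s x≤y) = ⊥-elim (x≢y (NP.≤-antisym x≤y y≤x))

  exchange-trans : ∀ {a b c d e f} → a + b ≤ c + d → d + e ≤ b + f → a + e ≤ c + f
  exchange-trans {a} {b} {c} {d} {e} {f} h₁ h₂ = NP.+-cancelˡ-≤ (b + d) _ _
    (subst₂ _≤_ (lhs a b d e) (rhs c d b f) (NP.+-mono-≤ h₁ h₂))
    where
    lhs : ∀ a b d e → (a + b) + (d + e) ≡ (b + d) + (a + e)
    lhs = solve-∀
    rhs : ∀ c d b f → (c + d) + (b + f) ≡ (b + d) + (c + f)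
    rhs = solve-∀

  exchange-∸ : ∀ {l l' a b c d} → l ≤ a → l ≤ b → l' ≤ c → l' ≤ d →
               c + a ≤ b + d → (c ∸ l') + (a ∸ l) ≤ (b ∸ l) + (d ∸ l')
  exchange-∸ {l} {l'} la lb lc ld h
    with NP.m≤n⇒∃[o]m+o≡n la | NP.m≤n⇒∃[o]m+o≡n lb | NP.m≤n⇒∃[o]m+o≡n lc | NP.m≤n⇒∃[o]m+o≡n ld
  ... | a , refl | b , refl | c , refl | d , refl =
    subst₂ _≤_ (sym (cong₂ _+_ (NP.m+n∸m≡n l' c) (NP.m+n∸m≡n l a)))
               (sym (cong₂ _+_ (NP.m+n∸m≡n l b) (NP.m+n∸m≡n l' d)))
      (NP.+-cancelˡ-≤ (l + l') _ _ (subst₂ _≤_ (lhs l l' a c) (rhs l l' b d) h))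
    where
    lhs : ∀ l l' a c → (l' + c) + (l + a) ≡ (l + l') + (c + a)
    lhs = solve-∀
    rhs : ∀ l l' b d → (l + b) + (l' + d) ≡ (l + l') + (b + d)
    rhs = solve-∀

  ∸-split : ∀ {b c d} → b ≤ c → c ≤ d → d ∸ b ≡ (d ∸ c) + (c ∸ b)
  ∸-split {b} b≤c c≤d with NP.m≤n⇒∃[o]m+o≡n b≤c
  ... | x , refl with NP.m≤n⇒∃[o]m+o≡n c≤d
  ... | y , refl = begin
    (b + x + y) ∸ b              ≡⟨ cong (_∸ b) (NP.+-assoc b x y) ⟩
    (b + (x + y)) ∸ b            ≡⟨ NP.m+n∸m≡n b (x + y) ⟩
    x + y                        ≡⟨ NP.+-comm x y ⟩
    y + x                        ≡⟨ sym (cong₂ _+_ (NP.m+n∸m≡n (b + x) y) (NP.m+n∸m≡n b x)) ⟩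
    (b + x + y ∸ (b + x)) + (b + x ∸ b) ∎
    where open ≡-Reasoning

  ∸-shift : ∀ {l b} d → l ≤ b → d ∸ b ≡ (d ∸ l) ∸ (b ∸ l)
  ∸-shift {l} {b} d l≤b = sym (trans (NP.∸-+-assoc d l (b ∸ l)) (cong (d ∸_) (NP.m+[n∸m]≡n l≤b)))

  ∸-shift₂ : ∀ {l l' P p P' p'} → l ≤ P → l ≤ p → l' ≤ P' → l' ≤ p' →
             (P + p') ∸ (P' + p) ≡ ((P ∸ l) + (p' ∸ l')) ∸ ((P' ∸ l') + (p ∸ l))
  ∸-shift₂ {l} {l'} h₁ h₂ h₃ h₄
    with NP.m≤n⇒∃[o]m+o≡n h₁ | NP.m≤n⇒∃[o]m+o≡n h₂ | NP.m≤n⇒∃[o]m+o≡n h₃ | NP.m≤n⇒∃[o]m+o≡n h₄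
  ... | P , refl | p , refl | Q , refl | q , refl = begin
    (l + P + (l' + q)) ∸ (l' + Q + (l + p))   ≡⟨ cong₂ _∸_ (regroup l l' P q) (regroup' l l' Q p) ⟩
    (l + l' + (P + q)) ∸ (l + l' + (Q + p))   ≡⟨ NP.[m+n]∸[m+o]≡n∸o (l + l') (P + q) (Q + p) ⟩
    (P + q) ∸ (Q + p)                         ≡⟨ sym (cong₂ _∸_ (cong₂ _+_ (NP.m+n∸m≡n l P) (NP.m+n∸m≡n l' q))
                                                                 (cong₂ _+_ (NP.m+n∸m≡n l' Q) (NP.m+n∸m≡n l p))) ⟩
    ((l + P ∸ l) + (l' + q ∸ l')) ∸ ((l' + Q ∸ l') + (l + p ∸ l)) ∎
    where
    open ≡-Reasoning
    regroup : ∀ a b x y → (a + x) + (b + y) ≡ (a + b) + (x + y)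
    regroup = solve-∀
    regroup' : ∀ a b x y → (b + x) + (a + y) ≡ (a + b) + (x + y)
    regroup' = solve-∀

  offset-≤ : ∀ {Rd Rd' δ δ'} → (Rd' + δ') + Rd ≤ (Rd + δ) + Rd' → δ' ≤ δ
  offset-≤ {Rd} {Rd'} {δ} {δ'} h = NP.+-cancelˡ-≤ (Rd + Rd') _ _ (subst₂ _≤_ (lhs Rd Rd' δ') (rhs Rd Rd' δ) h)
    where
    lhs : ∀ a b x → (b + x) + a ≡ (a + b) + x
    lhs = solve-∀
    rhs : ∀ a b x → (a + x) + b ≡ (a + b) + x
    rhs = solve-∀

  ∸-offsets : ∀ {R R' Rd Rd' δ δ' ra ra'} → R ≡ Rd + δ → R' ≡ Rd' + δ' → δ' ≤ δ → Rd' + ra ≤ Rd + ra' →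
              (R + ra') ∸ (R' + ra) ≡ (δ ∸ δ') + ((Rd + ra') ∸ (Rd' + ra))
  ∸-offsets {Rd = Rd} {Rd'} {δ' = δ'} {ra} {ra'} refl refl δ'≤δ h with NP.m≤n⇒∃[o]m+o≡n δ'≤δ
  ... | j , refl = begin
    (Rd + (δ' + j) + ra') ∸ (Rd' + δ' + ra)      ≡⟨ cong₂ _∸_ (lhs Rd δ' j ra') (rhs Rd' δ' ra) ⟩
    (δ' + (j + (Rd + ra'))) ∸ (δ' + (Rd' + ra))  ≡⟨ NP.[m+n]∸[m+o]≡n∸o δ' (j + (Rd + ra')) (Rd' + ra) ⟩
    (j + (Rd + ra')) ∸ (Rd' + ra)                ≡⟨ NP.+-∸-assoc j h ⟩
    j + ((Rd + ra') ∸ (Rd' + ra))                ≡⟨ cong (_+ ((Rd + ra') ∸ (Rd' + ra))) (sym (NP.m+n∸m≡n δ' j)) ⟩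
    ((δ' + j) ∸ δ') + ((Rd + ra') ∸ (Rd' + ra)) ∎
    where
    open ≡-Reasoning
    lhs : ∀ a d j x → (a + (d + j)) + x ≡ d + (j + (a + x))
    lhs = solve-∀
    rhs : ∀ a d x → (a + d) + x ≡ d + (a + x)
    rhs = solve-∀

  -- The nullity of A ∪ {ℓ}: |A| + 1 − r splits into the loop part 1 − ρ and the rest.
  nullity-split : ∀ {l ri k} → l ≤ 1 → l ≤ ri → ri ≤ l + k → suc k ∸ ri ≡ (1 ∸ l) + (k ∸ (ri ∸ l))
  nullity-split {zero} _ _ ri≤k = NP.+-∸-assoc 1 ri≤k
  nullity-split {suc zero} {suc ri} _ _ _ = refl
  nullity-split {suc (suc l)} (s≤s ())

  -- Subsets of Fin n.  The library lemmas take the sets explicitly; these forms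
  -- with implicit sets keep the inclusion arguments readable.

  ⊆∪ˡ : {p q : Subset n} → p ⊆ p ∪ q
  ⊆∪ˡ {q = q} = p⊆p∪q q

  ⊆∪ʳ : {p q : Subset n} → q ⊆ p ∪ q
  ⊆∪ʳ {p = p} {q} = q⊆p∪q p q

  ∪⁻ : {p q : Subset n} {x : Fin n} → x ∈ p ∪ q → x ∈ p ⊎ x ∈ q
  ∪⁻ {p = p} {q} = x∈p∪q⁻ p q

  ∩⁻ : {p q : Subset n} {x : Fin n} → x ∈ p ∩ q → x ∈ p × x ∈ q
  ∩⁻ {p = p} {q} = x∈p∩q⁻ p q

  ∪-lub : {p q s : Subset n} → p ⊆ s → q ⊆ s → p ∪ q ⊆ s
  ∪-lub p⊆s q⊆s x∈ with ∪⁻ x∈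
  ... | inj₁ x∈p = p⊆s x∈p
  ... | inj₂ x∈q = q⊆s x∈q

  ∩-glb : {p q s : Subset n} → s ⊆ p → s ⊆ q → s ⊆ p ∩ q
  ∩-glb s⊆p s⊆q x∈ = x∈p∩q⁺ (s⊆p x∈ , s⊆q x∈)

  ⁅⁆⁻ : {x y : Fin n} → x ∈ ⁅ y ⁆ → x ≡ y
  ⁅⁆⁻ {y = y} = x∈⁅y⁆⇒x≡y y

  ─⁻ˡ : {p q : Subset n} {x : Fin n} → x ∈ p ─ q → x ∈ p
  ─⁻ˡ {p = p} {q} = p─q⊆p p q

  ─⁻ʳ : {p q : Subset n} {x : Fin n} → x ∈ p ─ q → x ∉ q
  ─⁻ʳ {p = _ ∷ _} {outside ∷ _} here ()
  ─⁻ʳ {p = _ ∷ _} {_ ∷ _} (there x∈) (there x∈q) = ─⁻ʳ x∈ x∈q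

  -⁻ : {p : Subset n} {x y : Fin n} → x ∈ p - y → x ∈ p × x ≢ y
  -⁻ x∈ = ─⁻ˡ x∈ , λ x≡y → ─⁻ʳ x∈ (subst (_∈ ⁅ _ ⁆) (sym x≡y) (x∈⁅x⁆ _))

  -⁺ : {p : Subset n} {x y : Fin n} → x ∈ p → x ≢ y → x ∈ p - y
  -⁺ = x∈p∧x≢y⇒x∈p-y

  -⊆ : {p : Subset n} {y : Fin n} → p - y ⊆ p
  -⊆ x∈ = proj₁ (-⁻ x∈)

  ∣∪∣+∣∩∣ : ∀ (p q : Subset n) → ∣ p ∪ q ∣ + ∣ p ∩ q ∣ ≡ ∣ p ∣ + ∣ q ∣
  ∣∪∣+∣∩∣ [] [] = refl
  ∣∪∣+∣∩∣ (inside ∷ p) (inside ∷ q) =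
    cong suc (trans (NP.+-suc _ _) (trans (cong suc (∣∪∣+∣∩∣ p q)) (sym (NP.+-suc _ _))))
  ∣∪∣+∣∩∣ (inside ∷ p) (outside ∷ q) = cong suc (∣∪∣+∣∩∣ p q)
  ∣∪∣+∣∩∣ (outside ∷ p) (inside ∷ q) = trans (cong suc (∣∪∣+∣∩∣ p q)) (sym (NP.+-suc _ _))
  ∣∪∣+∣∩∣ (outside ∷ p) (outside ∷ q) = ∣∪∣+∣∩∣ p q

  ∣─∣+∣∩∣ : ∀ (p q : Subset n) → ∣ p ─ q ∣ + ∣ p ∩ q ∣ ≡ ∣ p ∣
  ∣─∣+∣∩∣ [] [] = refl
  ∣─∣+∣∩∣ (inside ∷ p) (inside ∷ q) = trans (NP.+-suc _ _) (cong suc (∣─∣+∣∩∣ p q))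
  ∣─∣+∣∩∣ (inside ∷ p) (outside ∷ q) = cong suc (∣─∣+∣∩∣ p q)
  ∣─∣+∣∩∣ (outside ∷ p) (inside ∷ q) = ∣─∣+∣∩∣ p q
  ∣─∣+∣∩∣ (outside ∷ p) (outside ∷ q) = ∣─∣+∣∩∣ p q

  ∣⊆∣ : {p q : Subset n} → p ⊆ q → ∣ q ∣ ≡ ∣ p ∣ + ∣ q ─ p ∣
  ∣⊆∣ {p = p} {q} p⊆q = begin
    ∣ q ∣                   ≡⟨ sym (∣─∣+∣∩∣ q p) ⟩
    ∣ q ─ p ∣ + ∣ q ∩ p ∣   ≡⟨ NP.+-comm ∣ q ─ p ∣ ∣ q ∩ p ∣ ⟩
    ∣ q ∩ p ∣ + ∣ q ─ p ∣   ≡⟨ cong (λ t → ∣ t ∣ + ∣ q ─ p ∣) (⊆-antisym (p∩q⊆q q p) (∩-glb p⊆q (λ x∈ → x∈))) ⟩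
    ∣ p ∣ + ∣ q ─ p ∣ ∎
    where open ≡-Reasoning

  ∣∪⁅⁆∣ : {p : Subset n} {e : Fin n} → e ∉ p → ∣ p ∪ ⁅ e ⁆ ∣ ≡ suc ∣ p ∣
  ∣∪⁅⁆∣ {n} {p} {e} e∉p = begin
    ∣ p ∪ ⁅ e ⁆ ∣                  ≡⟨ sym (NP.+-identityʳ _) ⟩
    ∣ p ∪ ⁅ e ⁆ ∣ + 0              ≡⟨ cong (∣ p ∪ ⁅ e ⁆ ∣ +_) (sym (trans (cong ∣_∣ disjoint) (∣⊥∣≡0 n))) ⟩
    ∣ p ∪ ⁅ e ⁆ ∣ + ∣ p ∩ ⁅ e ⁆ ∣  ≡⟨ ∣∪∣+∣∩∣ p ⁅ e ⁆ ⟩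
    ∣ p ∣ + ∣ ⁅ e ⁆ ∣              ≡⟨ cong (∣ p ∣ +_) (∣⁅x⁆∣≡1 e) ⟩
    ∣ p ∣ + 1                      ≡⟨ NP.+-comm _ 1 ⟩
    suc ∣ p ∣ ∎
    where
    open ≡-Reasoning
    disjoint : p ∩ ⁅ e ⁆ ≡ ⊥
    disjoint = ⊆-antisym (λ x∈ → let x∈p , x∈e = ∩⁻ x∈ in ⊥-elim (e∉p (subst (_∈ p) (⁅⁆⁻ x∈e) x∈p))) ⊥⊆

  ∣-∣ : {p : Subset n} {e : Fin n} → e ∈ p → ∣ p ∣ ≡ suc ∣ p - e ∣
  ∣-∣ {p = p} {e} e∈p = begin
    ∣ p ∣                      ≡⟨ sym (∣─∣+∣∩∣ p ⁅ e ⁆) ⟩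
    ∣ p - e ∣ + ∣ p ∩ ⁅ e ⁆ ∣  ≡⟨ cong (λ t → ∣ p - e ∣ + ∣ t ∣) e-only ⟩
    ∣ p - e ∣ + ∣ ⁅ e ⁆ ∣      ≡⟨ cong (∣ p - e ∣ +_) (∣⁅x⁆∣≡1 e) ⟩
    ∣ p - e ∣ + 1              ≡⟨ NP.+-comm _ 1 ⟩
    suc ∣ p - e ∣ ∎
    where
    open ≡-Reasoning
    e-only : p ∩ ⁅ e ⁆ ≡ ⁅ e ⁆
    e-only = ⊆-antisym (p∩q⊆q p ⁅ e ⁆) (λ x∈ → x∈p∩q⁺ (subst (_∈ p) (sym (⁅⁆⁻ x∈)) e∈p , x∈))

  ⊆-∪⁅⁆ : {p : Subset n} {e : Fin n} → p ⊆ (p - e) ∪ ⁅ e ⁆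
  ⊆-∪⁅⁆ {e = e} {x} x∈ with x FP.≟ e
  ... | yes refl = ⊆∪ʳ (x∈⁅x⁆ e)
  ... | no x≢e = ⊆∪ˡ (-⁺ x∈ x≢e)

  -- Consequences of the rank axioms.  "e ∈ cl(S)" is written r (S ∪ ⁅ e ⁆) ≡ r S.

  module Ranks {n : ℕ} (N : Matroid n) where

    r : Subset n → ℕ
    r = rank N

    mono : {X Y : Subset n} → X ⊆ Y → r X ≤ r Y
    mono {X} {Y} = rank-mono N X Y

    ⊆⊇⇒≡ : {X Y : Subset n} → X ⊆ Y → Y ⊆ X → r X ≡ r Y
    ⊆⊇⇒≡ X⊆Y Y⊆X = NP.≤-antisym (mono X⊆Y) (mono Y⊆X)

    r⊥≡0 : r ⊥ ≡ 0
    r⊥≡0 = NP.n≤0⇒n≡0 (subst (r ⊥ ≤_) (∣⊥∣≡0 n) (rank-card N ⊥))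

    submod-cover : {X Y Z W : Subset n} → Z ⊆ X ∪ Y → W ⊆ X ∩ Y → r Z + r W ≤ r X + r Y
    submod-cover {X} {Y} Z⊆ W⊆ = NP.≤-trans (NP.+-mono-≤ (mono Z⊆) (mono W⊆)) (rank-submod N X Y)

    subadditive : {X Y Z : Subset n} → Z ⊆ X ∪ Y → r Z ≤ r X + r Y
    subadditive {X} {Y} {Z} Z⊆ =
      subst (_≤ r X + r Y) (trans (cong (r Z +_) r⊥≡0) (NP.+-identityʳ _)) (submod-cover {W = ⊥} Z⊆ ⊥⊆)

    subadditive-card : {X Y Z : Subset n} → Z ⊆ X ∪ Y → r Z ≤ r X + ∣ Y ∣
    subadditive-card {X} {Y} Z⊆ = NP.≤-trans (subadditive Z⊆) (NP.+-monoʳ-≤ (r X) (rank-card N Y))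

    r-add≤ : ∀ X e → r (X ∪ ⁅ e ⁆) ≤ suc (r X)
    r-add≤ X e = subst (r (X ∪ ⁅ e ⁆) ≤_) (trans (cong (r X +_) (∣⁅x⁆∣≡1 e)) (NP.+-comm _ 1))
                   (subadditive-card {X} {⁅ e ⁆} (λ x∈ → x∈))

    closure-mono : ∀ {S T} e → S ⊆ T → r (S ∪ ⁅ e ⁆) ≡ r S → r (T ∪ ⁅ e ⁆) ≡ r T
    closure-mono {S} {T} e S⊆T e∈clS = NP.≤-antisym (NP.+-cancelʳ-≤ (r S) _ _ exchange) (mono ⊆∪ˡ)
      where
      exchange : r (T ∪ ⁅ e ⁆) + r S ≤ r T + r S
      exchange = begin
        r (T ∪ ⁅ e ⁆) + r S  ≤⟨ submod-cover {X = S ∪ ⁅ e ⁆} {Y = T}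
                                  (∪-lub (⊆∪ʳ {p = S ∪ ⁅ e ⁆}) (λ x∈ → ⊆∪ˡ (⊆∪ʳ {p = S} x∈)))
                                  (∩-glb ⊆∪ˡ S⊆T) ⟩
        r (S ∪ ⁅ e ⁆) + r T  ≡⟨ cong (_+ r T) e∈clS ⟩
        r S + r T            ≡⟨ NP.+-comm (r S) (r T) ⟩
        r T + r S ∎
        where open NP.≤-Reasoning

    indep-⊆ : ∀ {S T} → S ⊆ T → r T ≡ ∣ T ∣ → r S ≡ ∣ S ∣
    indep-⊆ {S} {T} S⊆T T-indep = NP.≤-antisym (rank-card N S) (NP.+-cancelʳ-≤ ∣ T ─ S ∣ _ _ bound)
      where
      bound : ∣ S ∣ + ∣ T ─ S ∣ ≤ r S + ∣ T ─ S ∣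
      bound = subst (_≤ r S + ∣ T ─ S ∣) (trans T-indep (∣⊆∣ S⊆T))
                (subadditive-card {S} {T ─ S} (λ {x} x∈T → case x x∈T))
        where
        case : ∀ x → x ∈ T → x ∈ S ∪ (T ─ S)
        case x x∈T with x ∈? S
        ... | yes x∈S = ⊆∪ˡ x∈S
        ... | no x∉S = ⊆∪ʳ {p = S} (x∈p∧x∉q⇒x∈p─q x∈T x∉S)

    indep-if-essential : ∀ k T → ∣ T ∣ ≡ k → (∀ f → f ∈ T → r (T - f) < r T) → r T ≡ ∣ T ∣
    indep-if-essential zero T ∣T∣≡0 _ =
      trans (NP.n≤0⇒n≡0 (subst (r T ≤_) ∣T∣≡0 (rank-card N T))) (sym ∣T∣≡0)
    indep-if-essential (suc k) T ∣T∣≡k+1 essential with nonempty? T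
    ... | no empty = ⊥-elim (NP.0≢1+n (trans (sym (trans (cong ∣_∣ (Empty-unique empty)) (∣⊥∣≡0 n))) ∣T∣≡k+1))
    ... | yes (f , f∈T) = NP.≤-antisym (rank-card N T)
            (subst (_≤ r T) (trans (cong suc T-f-indep) (sym (∣-∣ f∈T))) (essential f f∈T))
      where
      T-f-essential : ∀ g → g ∈ T - f → r ((T - f) - g) < r (T - f)
      T-f-essential g g∈T-f = <-by-cancel {a = r T} (submod-cover cover meet) (essential g g∈T)
        where
        g∈T = proj₁ (-⁻ g∈T-f)
        g≢f = proj₂ (-⁻ g∈T-f)
        cover : T ⊆ (T - f) ∪ (T - g)
        cover {x} x∈T with x FP.≟ f
        ... | yes refl = ⊆∪ʳ {p = T - f} (-⁺ x∈T (λ f≡g → g≢f (sym f≡g)))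
        ... | no x≢f = ⊆∪ˡ (-⁺ x∈T x≢f)
        meet : (T - f) - g ⊆ (T - f) ∩ (T - g)
        meet x∈ = let x∈T-f , x≢g = -⁻ x∈ in x∈p∩q⁺ (x∈T-f , -⁺ (-⊆ x∈T-f) x≢g)
      T-f-indep : r (T - f) ≡ ∣ T - f ∣
      T-f-indep = indep-if-essential k (T - f) (NP.suc-injective (trans (sym (∣-∣ f∈T)) ∣T∣≡k+1)) T-f-essential

    -- If e ∉ T lies in cl(T), some circuit C ⊆ T ∪ {e} contains e (induction on |T| ≤ k):
    -- either e ∈ cl(T - f) for some f ∈ T, or T is independent and T ∪ {e} is itself a circuit.
    circuit-through : ∀ k T e → e ∉ T → ∣ T ∣ ≤ k → r (T ∪ ⁅ e ⁆) ≡ r T →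
                      ∃ λ C → Circuit r C × C ⊆ T ∪ ⁅ e ⁆ × e ∈ C
    circuit-through k T e e∉T ∣T∣≤k e∈clT
      with FP.any? (λ f → (f ∈? T) ×-dec (r ((T - f) ∪ ⁅ e ⁆) ℕ.≟ r (T - f)))
    circuit-through zero T e e∉T ∣T∣≤k e∈clT | yes (f , f∈T , _) =
      ⊥-elim (NP.0≢1+n (sym (NP.n≤0⇒n≡0 (subst (_≤ 0) (∣-∣ f∈T) ∣T∣≤k))))
    circuit-through (suc k) T e e∉T ∣T∣≤k e∈clT | yes (f , f∈T , e∈clT-f) =
      let C , C-circuit , C⊆ , e∈C = circuit-through k (T - f) e (λ e∈ → e∉T (-⊆ e∈))
                                       (NP.≤-pred (subst (_≤ suc k) (∣-∣ f∈T) ∣T∣≤k)) e∈clT-f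
      in C , C-circuit , (λ x∈ → ∪-lub (λ x∈' → ⊆∪ˡ (-⊆ x∈')) ⊆∪ʳ (C⊆ x∈)) , e∈C
    circuit-through k T e e∉T ∣T∣≤k e∈clT | no none =
      T ∪ ⁅ e ⁆ , (dependent , minimal) , (λ x∈ → x∈) , ⊆∪ʳ {p = T} (x∈⁅x⁆ e)
      where
      e∉clT-f : ∀ f → f ∈ T → r ((T - f) ∪ ⁅ e ⁆) ≢ r (T - f)
      e∉clT-f f f∈T eq = none (f , f∈T , eq)
      essential : ∀ f → f ∈ T → r (T - f) < r T
      essential f f∈T = NP.≤∧≢⇒< (mono -⊆) λ eq → e∉clT-f f f∈T (NP.≤-antisym
        (NP.≤-trans (mono {Y = T ∪ ⁅ e ⁆} (∪-lub (λ x∈ → ⊆∪ˡ (-⊆ x∈)) ⊆∪ʳ)) (NP.≤-reflexive (trans e∈clT (sym eq))))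
        (mono ⊆∪ˡ))
      T-indep : r T ≡ ∣ T ∣
      T-indep = indep-if-essential _ T refl essential
      dependent : r (T ∪ ⁅ e ⁆) < ∣ T ∪ ⁅ e ⁆ ∣
      dependent = subst (r (T ∪ ⁅ e ⁆) <_) (sym (∣∪⁅⁆∣ e∉T)) (s≤s (NP.≤-reflexive (trans e∈clT T-indep)))
      minimal : ∀ D → D ⊂ T ∪ ⁅ e ⁆ → r D ≡ ∣ D ∣
      minimal D (D⊆ , g , g∈ , g∉D) with g FP.≟ e
      ... | yes refl = indep-⊆ D⊆T T-indep
        where
        D⊆T : D ⊆ T
        D⊆T {x} x∈D with ∪⁻ (D⊆ x∈D)
        ... | inj₁ x∈T = x∈T
        ... | inj₂ x≡e = ⊥-elim (g∉D (subst (_∈ D) (⁅⁆⁻ x≡e) x∈D))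
      ... | no g≢e = indep-⊆ D⊆T-g+e T-g+e-indep
        where
        g∈T : g ∈ T
        g∈T with ∪⁻ g∈
        ... | inj₁ g∈T = g∈T
        ... | inj₂ g≡e = ⊥-elim (g≢e (⁅⁆⁻ g≡e))
        D⊆T-g+e : D ⊆ (T - g) ∪ ⁅ e ⁆
        D⊆T-g+e {x} x∈D with ∪⁻ (D⊆ x∈D)
        ... | inj₁ x∈T = ⊆∪ˡ (-⁺ x∈T (λ x≡g → g∉D (subst (_∈ D) x≡g x∈D)))
        ... | inj₂ x≡e = ⊆∪ʳ {p = T - g} x≡e
        T-g+e-indep : r ((T - g) ∪ ⁅ e ⁆) ≡ ∣ (T - g) ∪ ⁅ e ⁆ ∣
        T-g+e-indep = trans (rank-step (r-add≤ (T - g) e) (mono ⊆∪ˡ) (e∉clT-f g g∈T))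
                        (trans (cong suc (indep-⊆ -⊆ T-indep)) (sym (∣∪⁅⁆∣ {p = T - g} (λ e∈ → e∉T (-⊆ e∈)))))

    circuit-closure : ∀ {C e} → Circuit r C → e ∈ C → r ((C - e) ∪ ⁅ e ⁆) ≡ r (C - e)
    circuit-closure {C} {e} (dependent , minimal) e∈C = trans (⊆⊇⇒≡ within ⊆-∪⁅⁆) rC≡rC-e
      where
      within : (C - e) ∪ ⁅ e ⁆ ⊆ C
      within = ∪-lub -⊆ (λ x∈ → subst (_∈ C) (sym (⁅⁆⁻ x∈)) e∈C)
      C-e-indep : r (C - e) ≡ ∣ C - e ∣
      C-e-indep = minimal (C - e) (-⊆ , e , e∈C , (λ e∈ → proj₂ (-⁻ e∈) refl))
      rC≡rC-e : r C ≡ r (C - e)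
      rC≡rC-e = NP.≤-antisym (NP.≤-pred (subst (r C <_) (trans (∣-∣ e∈C) (cong suc (sym C-e-indep))) dependent))
                             (mono -⊆)

  -- Activities in terms of ranks.  Both only look at elements larger than e.

  above : Fin n → Subset n
  above e = tabulate (λ f → does (e F.<? f))

  above⁺ : {e f : Fin n} → e F.< f → f ∈ above e
  above⁺ {e = e} {f} e<f = VP.lookup⇒[]= f _ (trans (VP.lookup∘tabulate _ f) (dec-true (e F.<? f) e<f))

  above⁻ : {e f : Fin n} → f ∈ above e → e F.< f
  above⁻ {e = e} {f} f∈ = witness (e F.<? f) (trans (sym (VP.lookup∘tabulate _ f)) (VP.[]=⇒lookup f∈))
    where
    witness : (d : Dec (e F.< f)) → does d ≡ true → e F.< f
    witness (yes e<f) _ = e<f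
    witness (no _) ()

  e∉above : {e : Fin n} → e ∉ above e
  e∉above e∈ = FP.<-irrefl refl (above⁻ e∈)

  ExtRank : Matroid n → Subset n → Fin n → Set
  ExtRank N A e = e ∉ A × rank N ((A ∩ above e) ∪ ⁅ e ⁆) ≡ rank N (A ∩ above e)

  module External {n : ℕ} (N : Matroid n) where
    open Ranks N

    ext⇔ : ∀ A e → ExtActive N A e ⇔ ExtRank N A e
    ext⇔ A e = mk⇔ by-closure by-circuit
      where
      -- the circuit minus its minimum e lies in A ∩ above e, and e is in its closure
      by-closure : ExtActive N A e → ExtRank N A e
      by-closure (e∉A , C , C-circuit , C⊆ , e∈C , e-min) =
        e∉A , closure-mono e C-e⊆ (circuit-closure C-circuit e∈C)
        where
        C-e⊆ : C - e ⊆ A ∩ above e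
        C-e⊆ {x} x∈ with -⁻ x∈
        ... | x∈C , x≢e with ∪⁻ (C⊆ x∈C)
        ...   | inj₂ x≡e = ⊥-elim (x≢e (⁅⁆⁻ x≡e))
        ...   | inj₁ x∈A = x∈p∩q⁺ (x∈A , above⁺ (FP.≤∧≢⇒< (e-min x x∈C) (λ e≡x → x≢e (sym e≡x))))
      -- a circuit through e inside (A ∩ above e) ∪ {e} has minimum e
      by-circuit : ExtRank N A e → ExtActive N A e
      by-circuit (e∉A , e∈cl) =
        let C , C-circuit , C⊆ , e∈C = circuit-through _ (A ∩ above e) e (λ e∈ → e∉A (proj₁ (∩⁻ e∈))) NP.≤-refl e∈cl
        in e∉A , C , C-circuit , (λ x∈ → ∪-lub (λ x∈' → ⊆∪ˡ (proj₁ (∩⁻ x∈'))) ⊆∪ʳ (C⊆ x∈)) , e∈C , e-min C C⊆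
        where
        e-min : ∀ C → C ⊆ (A ∩ above e) ∪ ⁅ e ⁆ → ∀ f → f ∈ C → e F.≤ f
        e-min C C⊆ f f∈C with ∪⁻ (C⊆ f∈C)
        ... | inj₁ f∈ = NP.<⇒≤ (above⁻ (proj₂ (∩⁻ f∈)))
        ... | inj₂ f≡e = FP.≤-reflexive (sym (⁅⁆⁻ f≡e))

  module Dual {n : ℕ} (N : Matroid n) where
    open Ranks N

    total≤ : ∀ A → r ⊤ ≤ ∣ A ∣ + r (∁ A)
    total≤ A = subst (r ⊤ ≤_) (NP.+-comm (r (∁ A)) ∣ A ∣) (subadditive-card {X = ∁ A} {Y = A} cover)
      where
      cover : ⊤ ⊆ ∁ A ∪ A
      cover {x} _ with x ∈? A
      ... | yes x∈A = ⊆∪ʳ {p = ∁ A} x∈A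
      ... | no x∉A = ⊆∪ˡ (x∉p⇒x∈∁p x∉A)

    dual-card : ∀ A → dualRank r A ≤ ∣ A ∣
    dual-card A = NP.≤-trans (NP.∸-monoˡ-≤ (r ⊤) (NP.+-monoʳ-≤ ∣ A ∣ (mono (⊆⊤ {p = ∁ A}))))
                             (NP.≤-reflexive (NP.m+n∸n≡m ∣ A ∣ (r ⊤)))

    dual-mono : ∀ A B → A ⊆ B → dualRank r A ≤ dualRank r B
    dual-mono A B A⊆B = NP.∸-monoˡ-≤ (r ⊤) (begin
      ∣ A ∣ + r (∁ A)                 ≤⟨ NP.+-monoʳ-≤ ∣ A ∣ (subadditive-card {X = ∁ B} {Y = B ─ A} cover) ⟩
      ∣ A ∣ + (r (∁ B) + ∣ B ─ A ∣)   ≡⟨ shuffle (∣ A ∣) (r (∁ B)) (∣ B ─ A ∣) ⟩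
      (∣ A ∣ + ∣ B ─ A ∣) + r (∁ B)   ≡⟨ cong (_+ r (∁ B)) (sym (∣⊆∣ A⊆B)) ⟩
      ∣ B ∣ + r (∁ B) ∎)
      where
      open NP.≤-Reasoning
      shuffle : ∀ a c d → a + (c + d) ≡ (a + d) + c
      shuffle = solve-∀
      cover : ∁ A ⊆ ∁ B ∪ (B ─ A)
      cover {x} x∈ with x ∈? B
      ... | yes x∈B = ⊆∪ʳ {p = ∁ B} (x∈p∧x∉q⇒x∈p─q x∈B (x∈∁p⇒x∉p x∈))
      ... | no x∉B = ⊆∪ˡ (x∉p⇒x∈∁p x∉B)

    dual-submod : ∀ A B → dualRank r (A ∪ B) + dualRank r (A ∩ B) ≤ dualRank r A + dualRank r B
    dual-submod A B = exchange-∸ (total≤ (A ∩ B)) (total≤ A) (total≤ (A ∪ B)) (total≤ B) (begin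
      (∣ A ∪ B ∣ + r (∁ (A ∪ B))) + (∣ A ∩ B ∣ + r (∁ (A ∩ B)))  ≡⟨ swap (∣ A ∪ B ∣) (r (∁ (A ∪ B))) (∣ A ∩ B ∣) (r (∁ (A ∩ B))) ⟩
      (∣ A ∪ B ∣ + ∣ A ∩ B ∣) + (r (∁ (A ∩ B)) + r (∁ (A ∪ B)))  ≤⟨ NP.+-monoʳ-≤ (∣ A ∪ B ∣ + ∣ A ∩ B ∣) complements ⟩
      (∣ A ∪ B ∣ + ∣ A ∩ B ∣) + (r (∁ A) + r (∁ B))              ≡⟨ cong (_+ (r (∁ A) + r (∁ B))) (∣∪∣+∣∩∣ A B) ⟩
      (∣ A ∣ + ∣ B ∣) + (r (∁ A) + r (∁ B))                      ≡⟨ middle-swap (∣ A ∣) (∣ B ∣) (r (∁ A)) (r (∁ B)) ⟩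
      (∣ A ∣ + r (∁ A)) + (∣ B ∣ + r (∁ B)) ∎)
      where
      open NP.≤-Reasoning
      swap : ∀ a b c d → (a + b) + (c + d) ≡ (a + c) + (d + b)
      swap = solve-∀
      middle-swap : ∀ a b c d → (a + b) + (c + d) ≡ (a + c) + (b + d)
      middle-swap = solve-∀
      complements : r (∁ (A ∩ B)) + r (∁ (A ∪ B)) ≤ r (∁ A) + r (∁ B)
      complements = submod-cover {X = ∁ A} {Y = ∁ B} de-morgan∩ de-morgan∪
        where
        de-morgan∩ : ∁ (A ∩ B) ⊆ ∁ A ∪ ∁ B
        de-morgan∩ {x} x∈ with x ∈? A
        ... | no x∉A = ⊆∪ˡ (x∉p⇒x∈∁p x∉A)
        ... | yes x∈A = ⊆∪ʳ {p = ∁ A} (x∉p⇒x∈∁p (λ x∈B → x∈∁p⇒x∉p x∈ (x∈p∩q⁺ (x∈A , x∈B))))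
        de-morgan∪ : ∁ (A ∪ B) ⊆ ∁ A ∩ ∁ B
        de-morgan∪ x∈ = x∈p∩q⁺ (x∉p⇒x∈∁p (λ x∈A → x∈∁p⇒x∉p x∈ (⊆∪ˡ x∈A)) ,
                                x∉p⇒x∈∁p (λ x∈B → x∈∁p⇒x∉p x∈ (⊆∪ʳ {p = A} x∈B)))

  dual : Matroid n → Matroid n
  dual N = record
    { rank = dualRank (rank N)
    ; rank-card = Dual.dual-card N
    ; rank-mono = Dual.dual-mono N
    ; rank-submod = Dual.dual-submod N
    }

  -- e is internally active for A iff e ∈ A and e is a coloop of the restriction of N to
  -- the complement of (E∖A) ∩ above e; this is external activity for E∖A in the dual.
  IntRank : Matroid n → Subset n → Fin n → Set
  IntRank N A e = e ∈ A × suc (rank N (∁ ((∁ A ∩ above e) ∪ ⁅ e ⁆))) ≡ rank N (∁ (∁ A ∩ above e))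

  module Internal {n : ℕ} (N : Matroid n) where
    open Ranks N
    open Dual N using (total≤)

    dual-closure⇔ : ∀ H e → e ∉ H →
      dualRank r (H ∪ ⁅ e ⁆) ≡ dualRank r H ⇔ suc (r (∁ (H ∪ ⁅ e ⁆))) ≡ r (∁ H)
    dual-closure⇔ H e e∉H = mk⇔
      (λ eq → NP.+-cancelˡ-≡ ∣ H ∣ _ _ (begin
        ∣ H ∣ + suc (r (∁ (H ∪ ⁅ e ⁆)))   ≡⟨ NP.+-suc ∣ H ∣ _ ⟩
        suc ∣ H ∣ + r (∁ (H ∪ ⁅ e ⁆))     ≡⟨ cong (_+ r (∁ (H ∪ ⁅ e ⁆))) (sym (∣∪⁅⁆∣ e∉H)) ⟩
        ∣ H ∪ ⁅ e ⁆ ∣ + r (∁ (H ∪ ⁅ e ⁆)) ≡⟨ NP.∸-cancelʳ-≡ (total≤ (H ∪ ⁅ e ⁆)) (total≤ H) eq ⟩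
        ∣ H ∣ + r (∁ H) ∎))
      (λ eq → cong (_∸ r ⊤) (begin
        ∣ H ∪ ⁅ e ⁆ ∣ + r (∁ (H ∪ ⁅ e ⁆)) ≡⟨ cong (_+ r (∁ (H ∪ ⁅ e ⁆))) (∣∪⁅⁆∣ e∉H) ⟩
        suc ∣ H ∣ + r (∁ (H ∪ ⁅ e ⁆))     ≡⟨ sym (NP.+-suc ∣ H ∣ _) ⟩
        ∣ H ∣ + suc (r (∁ (H ∪ ⁅ e ⁆)))   ≡⟨ cong (∣ H ∣ +_) eq ⟩
        ∣ H ∣ + r (∁ H) ∎))
      where open ≡-Reasoning

    int⇔ : ∀ A e → IntActive N A e ⇔ IntRank N A e
    int⇔ A e = ⇔.trans as-dual (⇔.trans (External.ext⇔ (dual N) (∁ A) e) from-dual)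
      where
      as-dual : IntActive N A e ⇔ ExtActive (dual N) (∁ A) e
      as-dual = mk⇔ (λ (e∈A , D) → x∈p⇒x∉∁p e∈A , D) (λ (e∉∁A , D) → x∉∁p⇒x∈p e∉∁A , D)
      from-dual : ExtRank (dual N) (∁ A) e ⇔ IntRank N A e
      from-dual = mk⇔
        (λ (e∉∁A , eq) → x∉∁p⇒x∈p e∉∁A , to (dual-closure⇔ (∁ A ∩ above e) e e∉H) eq)
        (λ (e∈A , eq) → x∈p⇒x∉∁p e∈A , from (dual-closure⇔ (∁ A ∩ above e) e e∉H) eq)
        where
        e∉H : e ∉ ∁ A ∩ above e
        e∉H e∈ = e∉above (proj₂ (∩⁻ e∈))

  -- A perspective is a quotient.

  Quotient : Matroid n → Matroid n → Set
  Quotient M M' = ∀ X Y → Y ⊆ X → rank M' X + rank M Y ≤ rank M X + rank M' Y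

  module PerspectiveQuotient {n : ℕ} (M M' : Matroid n) (P : Perspective M M') where
    module R = Ranks M
    module R' = Ranks M'

    -- Closure in M implies closure in M': a circuit of M through f contains a circuit of M' through f.
    closure-transfer : ∀ Y f → f ∉ Y → rank M (Y ∪ ⁅ f ⁆) ≡ rank M Y → rank M' (Y ∪ ⁅ f ⁆) ≡ rank M' Y
    closure-transfer Y f f∉Y f∈cl with R.circuit-through _ Y f f∉Y NP.≤-refl f∈cl
    ... | C , C-circuit , C⊆ , f∈C with P C C-circuit f f∈C
    ...   | C' , C'-circuit , C'⊆C , f∈C' = R'.closure-mono f C'-f⊆Y (R'.circuit-closure C'-circuit f∈C')
      where
      C'-f⊆Y : C' - f ⊆ Y
      C'-f⊆Y x∈ with -⁻ x∈
      ... | x∈C' , x≢f with ∪⁻ (C⊆ (C'⊆C x∈C'))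
      ...   | inj₁ x∈Y = x∈Y
      ...   | inj₂ x≡f = ⊥-elim (x≢f (⁅⁆⁻ x≡f))

    add-one : ∀ Y f → f ∉ Y → rank M' (Y ∪ ⁅ f ⁆) + rank M Y ≤ rank M (Y ∪ ⁅ f ⁆) + rank M' Y
    add-one Y f f∉Y with rank M (Y ∪ ⁅ f ⁆) ℕ.≟ rank M Y
    ... | yes f∈cl = NP.≤-reflexive (trans (cong₂ _+_ (closure-transfer Y f f∉Y f∈cl) (sym f∈cl))
                                           (NP.+-comm (rank M' Y) (rank M (Y ∪ ⁅ f ⁆))))
    ... | no f∉cl = begin
      rank M' (Y ∪ ⁅ f ⁆) + rank M Y  ≤⟨ NP.+-monoˡ-≤ (rank M Y) (R'.r-add≤ Y f) ⟩
      suc (rank M' Y + rank M Y)      ≡⟨ cong suc (NP.+-comm (rank M' Y) (rank M Y)) ⟩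
      suc (rank M Y) + rank M' Y      ≡⟨ cong (_+ rank M' Y) (sym (rank-step (R.r-add≤ Y f) (R.mono ⊆∪ˡ) f∉cl)) ⟩
      rank M (Y ∪ ⁅ f ⁆) + rank M' Y ∎
      where open NP.≤-Reasoning

    quotient : ∀ k X Y → Y ⊆ X → ∣ X ─ Y ∣ ≤ k → rank M' X + rank M Y ≤ rank M X + rank M' Y
    quotient k X Y Y⊆X ∣X─Y∣≤k with nonempty? (X ─ Y)
    ... | no empty = NP.≤-reflexive (trans (cong₂ _+_ (R'.⊆⊇⇒≡ X⊆Y Y⊆X) (R.⊆⊇⇒≡ Y⊆X X⊆Y))
                                           (NP.+-comm (rank M' Y) (rank M X)))
      where
      X⊆Y : X ⊆ Y
      X⊆Y {x} x∈X with x ∈? Y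
      ... | yes x∈Y = x∈Y
      ... | no x∉Y = ⊥-elim (empty (x , x∈p∧x∉q⇒x∈p─q x∈X x∉Y))
    quotient zero X Y Y⊆X ∣X─Y∣≤0 | yes (f , f∈) =
      ⊥-elim (NP.0≢1+n (sym (NP.n≤0⇒n≡0 (subst (_≤ 0) (∣-∣ f∈) ∣X─Y∣≤0))))
    quotient (suc k) X Y Y⊆X ∣X─Y∣≤k+1 | yes (f , f∈) =
      exchange-trans {b = rank M Y'} {d = rank M' Y'} (quotient k X Y' Y'⊆X ∣X─Y'∣≤k) (add-one Y f (─⁻ʳ f∈))
      where
      Y' = Y ∪ ⁅ f ⁆
      Y'⊆X : Y' ⊆ X
      Y'⊆X = ∪-lub Y⊆X (λ x∈ → subst (_∈ X) (sym (⁅⁆⁻ x∈)) (─⁻ˡ f∈))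
      X─Y'⊆ : X ─ Y' ⊆ (X ─ Y) - f
      X─Y'⊆ x∈ = -⁺ (x∈p∧x∉q⇒x∈p─q (─⁻ˡ x∈) (λ x∈Y → ─⁻ʳ x∈ (⊆∪ˡ x∈Y)))
                    (λ x≡f → ─⁻ʳ x∈ (⊆∪ʳ {p = Y} (subst (_∈ ⁅ f ⁆) (sym x≡f) (x∈⁅x⁆ f))))
      ∣X─Y'∣≤k : ∣ X ─ Y' ∣ ≤ k
      ∣X─Y'∣≤k = NP.≤-pred (NP.≤-trans (s≤s (p⊆q⇒∣p∣≤∣q∣ X─Y'⊆)) (subst (_≤ suc k) (∣-∣ f∈) ∣X─Y∣≤k+1))

  perspective⇒quotient : (M M' : Matroid n) → Perspective M M' → Quotient M M'
  perspective⇒quotient M M' P X Y Y⊆X = PerspectiveQuotient.quotient M M' P _ X Y Y⊆X NP.≤-refl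

  -- Subsets of Fin (suc n) as X ∷ʳ b, where b says whether the last element
  -- ℓ = fromℕ n belongs to the set; the other elements are the inject₁ g.

  tabulate-∷ʳ : ∀ {A : Set} {n} (f : Fin (suc n) → A) → tabulate f ≡ tabulate (f ∘ inject₁) ∷ʳ f (fromℕ n)
  tabulate-∷ʳ {n = zero} f = refl
  tabulate-∷ʳ {n = suc n} f = cong (f zero ∷_) (tabulate-∷ʳ (f ∘ suc))

  zipWith-∷ʳ : ∀ {A : Set} {n} (f : A → A → A) (xs ys : Vec A n) a b →
               zipWith f (xs ∷ʳ a) (ys ∷ʳ b) ≡ zipWith f xs ys ∷ʳ f a b
  zipWith-∷ʳ f [] [] a b = refl
  zipWith-∷ʳ f (x ∷ xs) (y ∷ ys) a b = cong (f x y ∷_) (zipWith-∷ʳ f xs ys a b)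

  replicate-∷ʳ : ∀ {A : Set} n (x : A) → replicate (suc n) x ≡ replicate n x ∷ʳ x
  replicate-∷ʳ zero x = refl
  replicate-∷ʳ (suc n) x = cong (x ∷_) (replicate-∷ʳ n x)

  ⊤-∷ʳ : ∀ n → ⊤ {suc n} ≡ ⊤ {n} ∷ʳ inside
  ⊤-∷ʳ n = replicate-∷ʳ n inside

  ∪-∷ʳ : ∀ (X Y : Subset n) a b → (X ∷ʳ a) ∪ (Y ∷ʳ b) ≡ (X ∪ Y) ∷ʳ (a ∨ b)
  ∪-∷ʳ = zipWith-∷ʳ _∨_

  ∩-∷ʳ : ∀ (X Y : Subset n) a b → (X ∷ʳ a) ∩ (Y ∷ʳ b) ≡ (X ∩ Y) ∷ʳ (a ∧ b)
  ∩-∷ʳ = zipWith-∷ʳ _∧_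

  ∁-∷ʳ : ∀ (X : Subset n) a → ∁ (X ∷ʳ a) ≡ ∁ X ∷ʳ not a
  ∁-∷ʳ X a = VP.map-∷ʳ not a X

  𝟙 : Bool → ℕ
  𝟙 true = 1
  𝟙 false = 0

  ∣∷ʳ∣ : ∀ (X : Subset n) b → ∣ X ∷ʳ b ∣ ≡ ∣ X ∣ + 𝟙 b
  ∣∷ʳ∣ [] true = refl
  ∣∷ʳ∣ [] false = refl
  ∣∷ʳ∣ (inside ∷ X) b = cong suc (∣∷ʳ∣ X b)
  ∣∷ʳ∣ (outside ∷ X) b = ∣∷ʳ∣ X b

  ∷ʳ-⊆ : {X Y : Subset n} (b : Bool) → X ⊆ Y → X ∷ʳ b ⊆ Y ∷ʳ b
  ∷ʳ-⊆ {X = []} {[]} b _ x∈ = x∈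
  ∷ʳ-⊆ {X = _ ∷ _} {_ ∷ _} b X⊆Y here with X⊆Y here
  ... | here = here
  ∷ʳ-⊆ {X = _ ∷ _} {_ ∷ _} b X⊆Y (there x∈) = there (∷ʳ-⊆ b (drop-∷-⊆ X⊆Y) x∈)

  out⊆in : (X : Subset n) → X ∷ʳ outside ⊆ X ∷ʳ inside
  out⊆in [] (there ())
  out⊆in (_ ∷ X) here = here
  out⊆in (_ ∷ X) (there x∈) = there (out⊆in X x∈)

  ∈-inject₁ : {X : Subset n} {b : Bool} {g : Fin n} → inject₁ g ∈ X ∷ʳ b ⇔ g ∈ X
  ∈-inject₁ = mk⇔ restrict extend
    where
    restrict : ∀ {n} {X : Subset n} {b} {g} → inject₁ g ∈ X ∷ʳ b → g ∈ X
    restrict {X = _ ∷ _} {g = zero} here = here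
    restrict {X = _ ∷ _} {g = suc g} (there g∈) = there (restrict g∈)
    extend : ∀ {n} {X : Subset n} {b} {g} → g ∈ X → inject₁ g ∈ X ∷ʳ b
    extend here = here
    extend (there g∈) = there (extend g∈)

  ∈-last⁻ : {X : Subset n} {b : Bool} → fromℕ n ∈ X ∷ʳ b → b ≡ inside
  ∈-last⁻ {X = []} here = refl
  ∈-last⁻ {X = _ ∷ _} (there ℓ∈) = ∈-last⁻ ℓ∈

  ∈-last⁺ : (X : Subset n) → fromℕ n ∈ X ∷ʳ inside
  ∈-last⁺ [] = here
  ∈-last⁺ (_ ∷ X) = there (∈-last⁺ X)

  ⁅inject₁⁆ : (g : Fin n) → ⁅ inject₁ g ⁆ ≡ ⁅ g ⁆ ∷ʳ outside
  ⁅inject₁⁆ {suc n} zero = cong (inside ∷_) (replicate-∷ʳ n outside)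
  ⁅inject₁⁆ (suc g) = cong (outside ∷_) (⁅inject₁⁆ g)

  ⁅last⁆ : ∀ n → ⁅ fromℕ n ⁆ ≡ ⊥ {n} ∷ʳ inside
  ⁅last⁆ zero = refl
  ⁅last⁆ (suc n) = cong (outside ∷_) (⁅last⁆ n)

  ∪⁅last⁆ : (S : Subset n) → (S ∷ʳ outside) ∪ ⁅ fromℕ n ⁆ ≡ S ∷ʳ inside
  ∪⁅last⁆ {n} S = trans (cong ((S ∷ʳ outside) ∪_) (⁅last⁆ n))
                  (trans (∪-∷ʳ S ⊥ outside inside) (cong (_∷ʳ inside) (∪-identityʳ S)))

  above-inject₁ : (g : Fin n) → above (inject₁ g) ≡ above g ∷ʳ inside
  above-inject₁ {n} g = trans (tabulate-∷ʳ (λ f → does (inject₁ g F.<? f))) (cong₂ _∷ʳ_ (VP.tabulate-cong order) (dec-true (inject₁ g F.<? fromℕ n) below-last))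
    where
    order : ∀ f → does (inject₁ g F.<? inject₁ f) ≡ does (g F.<? f)
    order f = does-⇔ (mk⇔ (subst₂ ℕ._<_ (FP.toℕ-inject₁ g) (FP.toℕ-inject₁ f))
                          (subst₂ ℕ._<_ (sym (FP.toℕ-inject₁ g)) (sym (FP.toℕ-inject₁ f)))) (inject₁ g F.<? inject₁ f) (g F.<? f)
    below-last : inject₁ g F.< fromℕ n
    below-last = subst (toℕ (inject₁ g) ℕ.<_) (sym (FP.toℕ-fromℕ n)) (FP.inject₁ℕ< g)

  above-last : ∀ n → above (fromℕ n) ≡ ⊥
  above-last n = Empty-unique (λ (f , f∈) → NP.<⇒≱ (above⁻ f∈) (FP.≤fromℕ f))

  count-cong : {P Q : Fin n → Set} (P? : Decidable P) (Q? : Decidable Q) →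
               (∀ e → P e ⇔ Q e) → count P? ≡ count Q?
  count-cong P? Q? P⇔Q = cong ∣_∣ (VP.tabulate-cong (λ e → does-⇔ (P⇔Q e) (P? e) (Q? e)))

  count-last : {P : Fin (suc n) → Set} (P? : Decidable P) →
               count P? ≡ count (P? ∘ inject₁) + 𝟙 (does (P? (fromℕ n)))
  count-last P? = trans (cong ∣_∣ (tabulate-∷ʳ (does ∘ P?))) (∣∷ʳ∣ (tabulate (does ∘ P? ∘ inject₁)) _)

  𝟙≡ : {P : Set} (P? : Dec P) {k : ℕ} → k ≤ 1 → (P ⇔ (k ≡ 1)) → 𝟙 (does P?) ≡ k
  𝟙≡ P? {zero} _ P⇔ = cong 𝟙 (dec-false P? (λ p → NP.0≢1+n (to P⇔ p)))
  𝟙≡ P? {suc zero} _ P⇔ = cong 𝟙 (dec-true P? (from P⇔ refl))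
  𝟙≡ P? {suc (suc k)} (s≤s ())

  sum-cong : ∀ n {f g : Subset n → ℤ} → (∀ A → f A ≡ g A) → sumSubsets n f ≡ sumSubsets n g
  sum-cong zero f≗g = f≗g []
  sum-cong (suc n) f≗g = cong₂ Int._+_ (sum-cong n (f≗g ∘ (inside ∷_))) (sum-cong n (f≗g ∘ (outside ∷_)))

  sum-scale : ∀ n c (f : Subset n → ℤ) → sumSubsets n (λ A → c Int.* f A) ≡ c Int.* sumSubsets n f
  sum-scale zero c f = refl
  sum-scale (suc n) c f = trans (cong₂ Int._+_ (sum-scale n c _) (sum-scale n c _)) (sym (ℤP.*-distribˡ-+ c _ _))

  sum-last : ∀ n (f : Subset (suc n) → ℤ) →
    sumSubsets (suc n) f ≡ sumSubsets n (λ A → f (A ∷ʳ inside)) Int.+ sumSubsets n (λ A → f (A ∷ʳ outside))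
  sum-last zero f = refl
  sum-last (suc n) f = trans (cong₂ Int._+_ (sum-last n (f ∘ (inside ∷_))) (sum-last n (f ∘ (outside ∷_))))
    (interchange (sumSubsets n (λ A → f (inside ∷ (A ∷ʳ inside)))) (sumSubsets n (λ A → f (inside ∷ (A ∷ʳ outside))))
                 (sumSubsets n (λ A → f (outside ∷ (A ∷ʳ inside)))) (sumSubsets n (λ A → f (outside ∷ (A ∷ʳ outside)))))
    where
    interchange : ∀ a b c d → (a Int.+ b) Int.+ (c Int.+ d) ≡ (a Int.+ c) Int.+ (b Int.+ d)
    interchange = ℤSolver.solve-∀

  sum-split : ∀ n (f : Subset (suc n) → ℤ) (g h : Subset n → ℤ) c d →
    (∀ A → f (A ∷ʳ inside) ≡ c Int.* g A) → (∀ A → f (A ∷ʳ outside) ≡ d Int.* h A) →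
    sumSubsets (suc n) f ≡ c Int.* sumSubsets n g Int.+ d Int.* sumSubsets n h
  sum-split n f g h c d f-in f-out = trans (sum-last n f)
    (cong₂ Int._+_ (trans (sum-cong n f-in) (sum-scale n c g)) (trans (sum-cong n f-out) (sum-scale n d h)))

  ∁⊥ : ∀ n → ∁ (⊥ {n}) ≡ ⊤
  ∁⊥ n = VP.map-replicate not outside n

  outside≢inside : outside ≢ inside
  outside≢inside ()

  -- Deletion and contraction of the last element ℓ.

  module Minors {m : ℕ} (N : Matroid (suc m)) where
    open Ranks N

    ℓ : Fin (suc m)
    ℓ = fromℕ m

    -- ρ = r({ℓ}) is 0 if ℓ is a loop and 1 otherwise.
    ρ : ℕ
    ρ = r ⁅ ℓ ⁆

    ρ≤1 : ρ ≤ 1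
    ρ≤1 = subst (ρ ≤_) (∣⁅x⁆∣≡1 ℓ) (rank-card N ⁅ ℓ ⁆)

    ρ≤ : ∀ S → ρ ≤ r (S ∷ʳ inside)
    ρ≤ S = mono (λ x∈ → subst (_∈ S ∷ʳ inside) (sym (⁅⁆⁻ x∈)) (∈-last⁺ S))

    with-ℓ≤ : ∀ S → r (S ∷ʳ inside) ≤ ρ + r (S ∷ʳ outside)
    with-ℓ≤ S = subadditive {X = ⁅ ℓ ⁆} {Y = S ∷ʳ outside}
                  (⊆-reflexive (trans (sym (∪⁅last⁆ S)) (∪-comm (S ∷ʳ outside) ⁅ ℓ ⁆)))

    deletion : Matroid m
    deletion = record
      { rank = λ S → r (S ∷ʳ outside)
      ; rank-card = λ S → subst (r (S ∷ʳ outside) ≤_) (trans (∣∷ʳ∣ S outside) (NP.+-identityʳ _))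
                              (rank-card N (S ∷ʳ outside))
      ; rank-mono = λ S T S⊆T → mono (∷ʳ-⊆ outside S⊆T)
      ; rank-submod = λ S T → subst₂ (λ U V → r U + r V ≤ r (S ∷ʳ outside) + r (T ∷ʳ outside))
                                (∪-∷ʳ S T outside outside) (∩-∷ʳ S T outside outside)
                                (rank-submod N (S ∷ʳ outside) (T ∷ʳ outside))
      }

    contraction : Matroid m
    contraction = record
      { rank = λ S → r (S ∷ʳ inside) ∸ ρ
      ; rank-card = λ S → NP.m≤n+o⇒m∸n≤o _ ρ (NP.≤-trans (with-ℓ≤ S) (NP.+-monoʳ-≤ ρ (rank-card deletion S)))
      ; rank-mono = λ S T S⊆T → NP.∸-monoˡ-≤ ρ (mono (∷ʳ-⊆ inside S⊆T))
      ; rank-submod = λ S T → exchange-∸ (ρ≤ (S ∩ T)) (ρ≤ S) (ρ≤ (S ∪ T)) (ρ≤ T)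
                                (subst₂ (λ U V → r U + r V ≤ r (S ∷ʳ inside) + r (T ∷ʳ inside))
                                  (∪-∷ʳ S T inside inside) (∩-∷ʳ S T inside inside)
                                  (rank-submod N (S ∷ʳ inside) (T ∷ʳ inside)))
      }

    deletion-shift : ∀ X → rank deletion X + 0 ≡ r (X ∷ʳ outside)
    deletion-shift X = NP.+-identityʳ _

    contraction-shift : ∀ X → rank contraction X + ρ ≡ r (X ∷ʳ inside)
    contraction-shift X = NP.m∸n+n≡m (ρ≤ X)

    -- δ = r(N) − r(N ∖ ℓ) is 1 if ℓ is a coloop and 0 otherwise.
    R Rd δ : ℕ
    R = r ⊤
    Rd = r (⊤ ∷ʳ outside)
    δ = R ∸ Rd

    R≡ : R ≡ r (⊤ ∷ʳ inside)
    R≡ = cong r (⊤-∷ʳ m)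

    Rd≤R : Rd ≤ R
    Rd≤R = mono ⊆⊤

    R≡Rd+δ : R ≡ Rd + δ
    R≡Rd+δ = sym (NP.m+[n∸m]≡n Rd≤R)

    δ≤1 : δ ≤ 1
    δ≤1 = NP.m≤n+o⇒m∸n≤o R Rd (begin
      R              ≡⟨ R≡ ⟩
      r (⊤ ∷ʳ inside) ≤⟨ with-ℓ≤ ⊤ ⟩
      ρ + Rd         ≤⟨ NP.+-monoˡ-≤ Rd ρ≤1 ⟩
      1 + Rd         ≡⟨ NP.+-comm 1 Rd ⟩
      Rd + 1 ∎)
      where open NP.≤-Reasoning

    loop-or-not : ρ ≡ 0 ⊎ ρ ≡ 1
    loop-or-not with ρ | ρ≤1
    ... | zero | _ = inj₁ refl
    ... | suc zero | _ = inj₂ refl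
    ... | suc (suc _) | s≤s ()

    coloop-or-not : δ ≡ 0 ⊎ δ ≡ 1
    coloop-or-not with δ | δ≤1
    ... | zero | _ = inj₁ refl
    ... | suc zero | _ = inj₂ refl
    ... | suc (suc _) | s≤s ()

    loop⇒δ≡0 : ρ ≡ 0 → δ ≡ 0
    loop⇒δ≡0 ρ≡0 = NP.m≤n⇒m∸n≡0 (subst (λ k → R ≤ k + Rd) ρ≡0 (subst (_≤ ρ + Rd) (sym R≡) (with-ℓ≤ ⊤)))

    loop⇒contraction≗deletion : ρ ≡ 0 → ∀ S → rank contraction S ≡ rank deletion S
    loop⇒contraction≗deletion ρ≡0 S = trans (cong (r (S ∷ʳ inside) ∸_) ρ≡0)
      (NP.≤-antisym (subst (λ k → r (S ∷ʳ inside) ≤ k + r (S ∷ʳ outside)) ρ≡0 (with-ℓ≤ S)) (mono (out⊆in S)))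

    coloop⇒contraction≗deletion : δ ≡ 1 → ∀ S → rank contraction S ≡ rank deletion S
    coloop⇒contraction≗deletion δ≡1 S with loop-or-not
    ... | inj₁ ρ≡0 = ⊥-elim (NP.0≢1+n (trans (sym (loop⇒δ≡0 ρ≡0)) δ≡1))
    ... | inj₂ ρ≡1 = trans (cong (_∸ ρ) ℓ-raises-rank) (cong (suc (r (S ∷ʳ outside)) ∸_) ρ≡1)
      where
      -- otherwise ℓ ∈ cl(S ∷ʳ outside) ⊆ cl(⊤ ∷ʳ outside), i.e. δ = 0
      ℓ∉cl : r (S ∷ʳ inside) ≢ r (S ∷ʳ outside)
      ℓ∉cl eq = NP.0≢1+n (trans (sym δ≡0) δ≡1)
        where
        ℓ∈cl⊤ : r ((⊤ ∷ʳ outside) ∪ ⁅ ℓ ⁆) ≡ Rd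
        ℓ∈cl⊤ = closure-mono ℓ (∷ʳ-⊆ outside ⊆⊤) (trans (cong r (∪⁅last⁆ S)) eq)
        δ≡0 : δ ≡ 0
        δ≡0 = trans (cong (_∸ Rd) (trans R≡ (trans (cong r (sym (∪⁅last⁆ ⊤))) ℓ∈cl⊤))) (NP.n∸n≡0 Rd)
      ℓ-raises-rank : r (S ∷ʳ inside) ≡ suc (r (S ∷ʳ outside))
      ℓ-raises-rank = rank-step (subst (λ k → r (S ∷ʳ inside) ≤ k + r (S ∷ʳ outside)) ρ≡1 (with-ℓ≤ S))
                                (mono (out⊆in S)) ℓ∉cl

    -- ℓ is the largest element, so the sets consulted by its activities are trivial.
    nothing-above-ℓ : ∀ X → X ∩ above ℓ ≡ ⊥
    nothing-above-ℓ X = trans (cong (X ∩_) (above-last m)) (∩-zeroʳ X)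

    ext-ℓ-in : ∀ A → 𝟙 (does (extActive? N (A ∷ʳ inside) ℓ)) ≡ 0
    ext-ℓ-in A = cong 𝟙 (dec-false (extActive? N (A ∷ʳ inside) ℓ) (λ (ℓ∉ , _) → ℓ∉ (∈-last⁺ A)))

    int-ℓ-out : ∀ A → 𝟙 (does (intActive? N (A ∷ʳ outside) ℓ)) ≡ 0
    int-ℓ-out A = cong 𝟙 (dec-false (intActive? N (A ∷ʳ outside) ℓ) (λ (ℓ∈ , _) → outside≢inside (∈-last⁻ ℓ∈)))

    ext-ℓ-out : ∀ A → 𝟙 (does (extActive? N (A ∷ʳ outside) ℓ)) ≡ 1 ∸ ρ
    ext-ℓ-out A = 𝟙≡ (extActive? N (A ∷ʳ outside) ℓ) (NP.m∸n≤m 1 ρ) (⇔.trans (External.ext⇔ N _ ℓ) is-loop)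
      where
      ρ≡0⇔ : ρ ≡ 0 ⇔ 1 ∸ ρ ≡ 1
      ρ≡0⇔ = mk⇔ (λ ρ≡0 → cong (1 ∸_) ρ≡0) (λ eq → ρ≡0 (loop-or-not) eq)
        where
        ρ≡0 : ρ ≡ 0 ⊎ ρ ≡ 1 → 1 ∸ ρ ≡ 1 → ρ ≡ 0
        ρ≡0 (inj₁ ρ≡0) _ = ρ≡0
        ρ≡0 (inj₂ ρ≡1) eq = ⊥-elim (NP.0≢1+n (trans (cong (1 ∸_) (sym ρ≡1)) eq))
      X = A ∷ʳ outside
      r-below : r (X ∩ above ℓ) ≡ 0
      r-below = trans (cong r (nothing-above-ℓ X)) r⊥≡0
      with-ℓ : (X ∩ above ℓ) ∪ ⁅ ℓ ⁆ ≡ ⁅ ℓ ⁆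
      with-ℓ = trans (cong (_∪ ⁅ ℓ ⁆) (nothing-above-ℓ X)) (∪-identityˡ ⁅ ℓ ⁆)
      is-loop : ExtRank N X ℓ ⇔ 1 ∸ ρ ≡ 1
      is-loop = mk⇔
        (λ (_ , eq) → to ρ≡0⇔ (trans (sym (cong r with-ℓ)) (trans eq r-below)))
        (λ eq → (λ ℓ∈ → outside≢inside (∈-last⁻ ℓ∈)) ,
                trans (cong r with-ℓ) (trans (from ρ≡0⇔ eq) (sym r-below)))

    int-ℓ-in : ∀ A → 𝟙 (does (intActive? N (A ∷ʳ inside) ℓ)) ≡ δ
    int-ℓ-in A = 𝟙≡ (intActive? N (A ∷ʳ inside) ℓ) δ≤1 (⇔.trans (Internal.int⇔ N _ ℓ) is-coloop)
      where
      X = ∁ (A ∷ʳ inside)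
      all : ∁ (X ∩ above ℓ) ≡ ⊤
      all = trans (cong ∁ (nothing-above-ℓ X)) (∁⊥ (suc m))
      all-but-ℓ : ∁ ((X ∩ above ℓ) ∪ ⁅ ℓ ⁆) ≡ ⊤ ∷ʳ outside
      all-but-ℓ = begin
        ∁ ((X ∩ above ℓ) ∪ ⁅ ℓ ⁆) ≡⟨ cong (λ S → ∁ (S ∪ ⁅ ℓ ⁆)) (nothing-above-ℓ X) ⟩
        ∁ (⊥ ∪ ⁅ ℓ ⁆)            ≡⟨ cong ∁ (trans (∪-identityˡ ⁅ ℓ ⁆) (⁅last⁆ m)) ⟩
        ∁ (⊥ ∷ʳ inside)          ≡⟨ ∁-∷ʳ ⊥ inside ⟩
        ∁ ⊥ ∷ʳ outside           ≡⟨ cong (_∷ʳ outside) (∁⊥ m) ⟩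
        ⊤ ∷ʳ outside ∎
        where open ≡-Reasoning
      is-coloop : IntRank N (A ∷ʳ inside) ℓ ⇔ δ ≡ 1
      is-coloop = mk⇔
        (λ (_ , eq) → trans (cong (_∸ Rd) (sym (subst₂ (λ S T → suc (r S) ≡ r T) all-but-ℓ all eq)))
                            (NP.m+n∸n≡m 1 Rd))
        (λ δ≡1 → ∈-last⁺ A , subst₂ (λ S T → suc (r S) ≡ r T) (sym all-but-ℓ) (sym all)
                                (sym (trans R≡Rd+δ (trans (cong (Rd +_) δ≡1) (NP.+-comm Rd 1)))))

  -- Activities of the elements other than ℓ only depend on the sets X ∷ʳ b.

  ∩above-inject₁ : ∀ (X : Subset n) b g → (X ∷ʳ b) ∩ above (inject₁ g) ≡ (X ∩ above g) ∷ʳ b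
  ∩above-inject₁ X b g = trans (cong ((X ∷ʳ b) ∩_) (above-inject₁ g))
    (trans (∩-∷ʳ X (above g) b inside) (cong ((X ∩ above g) ∷ʳ_) (BP.∧-identityʳ b)))

  ∪⁅inject₁⁆ : ∀ (X : Subset n) b g → (X ∷ʳ b) ∪ ⁅ inject₁ g ⁆ ≡ (X ∪ ⁅ g ⁆) ∷ʳ b
  ∪⁅inject₁⁆ X b g = trans (cong ((X ∷ʳ b) ∪_) (⁅inject₁⁆ g))
    (trans (∪-∷ʳ X ⁅ g ⁆ b outside) (cong ((X ∪ ⁅ g ⁆) ∷ʳ_) (BP.∨-identityʳ b)))

  ∁-∷ʳ-not : ∀ (X : Subset n) b → ∁ (X ∷ʳ not b) ≡ ∁ X ∷ʳ b
  ∁-∷ʳ-not X b = trans (∁-∷ʳ X (not b)) (cong (∁ X ∷ʳ_) (BP.not-involutive b))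

  -- N' is N restricted to the sets X ∷ʳ b, up to a constant shift c of the rank; both
  -- minors by ℓ are of this form.  Then the activities of inject₁ g in N and of g in N'
  -- agree, since their rank characterisations only compare ranks of such sets.
  module Transfer {m : ℕ} (N : Matroid (suc m)) (b : Bool) (N' : Matroid m) (c : ℕ)
                  (shift : ∀ X → rank N' X + c ≡ rank N (X ∷ʳ b)) where

    shift⇔ : ∀ k X Y → k + rank N' X ≡ rank N' Y ⇔ k + rank N (X ∷ʳ b) ≡ rank N (Y ∷ʳ b)
    shift⇔ k X Y = mk⇔
      (λ eq → begin
        k + rank N (X ∷ʳ b)   ≡⟨ cong (k +_) (sym (shift X)) ⟩
        k + (rank N' X + c)   ≡⟨ sym (NP.+-assoc k _ c) ⟩
        (k + rank N' X) + c   ≡⟨ cong (_+ c) eq ⟩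
        rank N' Y + c         ≡⟨ shift Y ⟩
        rank N (Y ∷ʳ b) ∎)
      (λ eq → NP.+-cancelʳ-≡ c _ _ (begin
        (k + rank N' X) + c   ≡⟨ NP.+-assoc k _ c ⟩
        k + (rank N' X + c)   ≡⟨ cong (k +_) (shift X) ⟩
        k + rank N (X ∷ʳ b)   ≡⟨ eq ⟩
        rank N (Y ∷ʳ b)       ≡⟨ sym (shift Y) ⟩
        rank N' Y + c ∎))
      where open ≡-Reasoning

    ext-rank : ∀ A g → ExtRank N (A ∷ʳ b) (inject₁ g) ⇔ ExtRank N' A g
    ext-rank A g = mk⇔
      (λ (g∉ , eq) → g∉ ∘ from ∈-inject₁ ,
                     from (shift⇔ 0 _ _) (subst₂ (λ S T → rank N S ≡ rank N T) with-g below eq))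
      (λ (g∉ , eq) → g∉ ∘ to ∈-inject₁ ,
                     subst₂ (λ S T → rank N S ≡ rank N T) (sym with-g) (sym below) (to (shift⇔ 0 _ _) eq))
      where
      below : (A ∷ʳ b) ∩ above (inject₁ g) ≡ (A ∩ above g) ∷ʳ b
      below = ∩above-inject₁ A b g
      with-g : ((A ∷ʳ b) ∩ above (inject₁ g)) ∪ ⁅ inject₁ g ⁆ ≡ ((A ∩ above g) ∪ ⁅ g ⁆) ∷ʳ b
      with-g = trans (cong (_∪ ⁅ inject₁ g ⁆) below) (∪⁅inject₁⁆ (A ∩ above g) b g)

    int-rank : ∀ A g → IntRank N (A ∷ʳ b) (inject₁ g) ⇔ IntRank N' A g
    int-rank A g = mk⇔
      (λ (g∈ , eq) → to ∈-inject₁ g∈ ,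
                     from (shift⇔ 1 _ _) (subst₂ (λ S T → suc (rank N S) ≡ rank N T) co-with-g co-below eq))
      (λ (g∈ , eq) → from ∈-inject₁ g∈ ,
                     subst₂ (λ S T → suc (rank N S) ≡ rank N T) (sym co-with-g) (sym co-below) (to (shift⇔ 1 _ _) eq))
      where
      flipped : ∁ (A ∷ʳ b) ∩ above (inject₁ g) ≡ (∁ A ∩ above g) ∷ʳ not b
      flipped = trans (cong (_∩ above (inject₁ g)) (∁-∷ʳ A b)) (∩above-inject₁ (∁ A) (not b) g)
      co-below : ∁ (∁ (A ∷ʳ b) ∩ above (inject₁ g)) ≡ ∁ (∁ A ∩ above g) ∷ʳ b
      co-below = trans (cong ∁ flipped) (∁-∷ʳ-not (∁ A ∩ above g) b)
      co-with-g : ∁ ((∁ (A ∷ʳ b) ∩ above (inject₁ g)) ∪ ⁅ inject₁ g ⁆) ≡ ∁ ((∁ A ∩ above g) ∪ ⁅ g ⁆) ∷ʳ b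
      co-with-g = trans (cong (λ S → ∁ (S ∪ ⁅ inject₁ g ⁆)) flipped)
                    (trans (cong ∁ (∪⁅inject₁⁆ (∁ A ∩ above g) (not b) g)) (∁-∷ʳ-not ((∁ A ∩ above g) ∪ ⁅ g ⁆) b))

    ε-transfer : ∀ A → count (extActive? N (A ∷ʳ b) ∘ inject₁) ≡ ε N' A
    ε-transfer A = count-cong (extActive? N (A ∷ʳ b) ∘ inject₁) (extActive? N' A) (λ g →
      ⇔.trans (External.ext⇔ N _ _) (⇔.trans (ext-rank A g) (⇔.sym (External.ext⇔ N' A g))))

    ι-transfer : ∀ A → count (intActive? N (A ∷ʳ b) ∘ inject₁) ≡ ι N' A
    ι-transfer A = count-cong (intActive? N (A ∷ʳ b) ∘ inject₁) (intActive? N' A) (λ g →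
      ⇔.trans (Internal.int⇔ N _ _) (⇔.trans (int-rank A g) (⇔.sym (Internal.int⇔ N' A g))))

  module Expansion (x u y v z : ℤ) where
    open Int using (_*_; _^_; 1ℤ)

    a b : ℤ
    a = (x Int.+ u) Int.- 1ℤ
    b = (y Int.+ v) Int.- 1ℤ

    tutteTerm : ∀ {k} → Matroid k → Matroid k → Subset k → ℤ
    tutteTerm N N' A = (a ^ cr N' A) * ((b ^ nl N A) * (z ^ rcd N N' A))

    activityTerm : ∀ {k} → Matroid k → Matroid k → Subset k → ℤ
    activityTerm N N' A = (x ^ ι N' A) * ((u ^ cr N' A) * ((y ^ ε N A) * ((v ^ nl N A) * (z ^ rcd N N' A))))

    activitySum : ∀ {k} → Matroid k → Matroid k → ℤ
    activitySum {k} N N' = sumSubsets k (activityTerm N N')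

    tutte-cong : ∀ {k} {N₁ N₂ N₁' N₂' : Matroid k} →
      (∀ S → rank N₁ S ≡ rank N₂ S) → (∀ S → rank N₁' S ≡ rank N₂' S) →
      tutte N₁ N₁' (x Int.+ u) (y Int.+ v) z ≡ tutte N₂ N₂' (x Int.+ u) (y Int.+ v) z
    tutte-cong {k} N₁≗N₂ N₁'≗N₂' = sum-cong k λ A →
      cong₂ _*_ (cong (a ^_) (cong₂ _∸_ (N₁'≗N₂' ⊤) (N₁'≗N₂' A)))
        (cong₂ _*_ (cong (b ^_) (cong (∣ A ∣ ∸_) (N₁≗N₂ A)))
          (cong (z ^_) (cong₂ _∸_ (cong₂ _+_ (N₁≗N₂ ⊤) (N₁'≗N₂' A)) (cong₂ _+_ (N₁'≗N₂' ⊤) (N₁≗N₂ A)))))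

    tutteTerm-split : ∀ {k k'} (N N' : Matroid k) (K K' : Matroid k') A B p q s →
      cr N' A ≡ p + cr K' B → nl N A ≡ q + nl K B → rcd N N' A ≡ s + rcd K K' B →
      tutteTerm N N' A ≡ (a ^ p * (b ^ q * z ^ s)) * tutteTerm K K' B
    tutteTerm-split N N' K K' A B p q s cr≡ nl≡ rcd≡ = begin
      tutteTerm N N' A
        ≡⟨ cong₂ _*_ (cong (a ^_) cr≡) (cong₂ _*_ (cong (b ^_) nl≡) (cong (z ^_) rcd≡)) ⟩
      a ^ (p + cr K' B) * (b ^ (q + nl K B) * z ^ (s + rcd K K' B))
        ≡⟨ cong₂ _*_ (ℤP.^-distribˡ-+-* a p _) (cong₂ _*_ (ℤP.^-distribˡ-+-* b q _) (ℤP.^-distribˡ-+-* z s _)) ⟩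
      (a ^ p * a ^ cr K' B) * ((b ^ q * b ^ nl K B) * (z ^ s * z ^ rcd K K' B))
        ≡⟨ regroup (a ^ p) (a ^ cr K' B) (b ^ q) (b ^ nl K B) (z ^ s) (z ^ rcd K K' B) ⟩
      (a ^ p * (b ^ q * z ^ s)) * tutteTerm K K' B ∎
      where
      open ≡-Reasoning
      regroup : ∀ A₁ A₂ B₁ B₂ C₁ C₂ → (A₁ * A₂) * ((B₁ * B₂) * (C₁ * C₂)) ≡ (A₁ * (B₁ * C₁)) * (A₂ * (B₂ * C₂))
      regroup = ℤSolver.solve-∀

    activityTerm-split : ∀ {k k'} (N N' : Matroid k) (K K' : Matroid k') A B i p e q s →
      ι N' A ≡ i + ι K' B → cr N' A ≡ p + cr K' B → ε N A ≡ e + ε K B →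
      nl N A ≡ q + nl K B → rcd N N' A ≡ s + rcd K K' B →
      activityTerm N N' A ≡ (x ^ i * (u ^ p * (y ^ e * (v ^ q * z ^ s)))) * activityTerm K K' B
    activityTerm-split N N' K K' A B i p e q s ι≡ cr≡ ε≡ nl≡ rcd≡ = begin
      activityTerm N N' A
        ≡⟨ cong₂ _*_ (cong (x ^_) ι≡) (cong₂ _*_ (cong (u ^_) cr≡)
             (cong₂ _*_ (cong (y ^_) ε≡) (cong₂ _*_ (cong (v ^_) nl≡) (cong (z ^_) rcd≡)))) ⟩
      x ^ (i + ι K' B) * (u ^ (p + cr K' B) * (y ^ (e + ε K B) * (v ^ (q + nl K B) * z ^ (s + rcd K K' B))))
        ≡⟨ cong₂ _*_ (ℤP.^-distribˡ-+-* x i _) (cong₂ _*_ (ℤP.^-distribˡ-+-* u p _)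
             (cong₂ _*_ (ℤP.^-distribˡ-+-* y e _) (cong₂ _*_ (ℤP.^-distribˡ-+-* v q _) (ℤP.^-distribˡ-+-* z s _)))) ⟩
      (x ^ i * x ^ ι K' B) * ((u ^ p * u ^ cr K' B) * ((y ^ e * y ^ ε K B) *
        ((v ^ q * v ^ nl K B) * (z ^ s * z ^ rcd K K' B))))
        ≡⟨ regroup (x ^ i) (x ^ ι K' B) (u ^ p) (u ^ cr K' B) (y ^ e) (y ^ ε K B)
                   (v ^ q) (v ^ nl K B) (z ^ s) (z ^ rcd K K' B) ⟩
      (x ^ i * (u ^ p * (y ^ e * (v ^ q * z ^ s)))) * activityTerm K K' B ∎
      where
      open ≡-Reasoning
      regroup : ∀ X₁ X₂ U₁ U₂ Y₁ Y₂ V₁ V₂ Z₁ Z₂ →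
        (X₁ * X₂) * ((U₁ * U₂) * ((Y₁ * Y₂) * ((V₁ * V₂) * (Z₁ * Z₂)))) ≡
        (X₁ * (U₁ * (Y₁ * (V₁ * Z₁)))) * (X₂ * (U₂ * (Y₂ * (V₂ * Z₂))))
      regroup = ℤSolver.solve-∀

    -- The shape of both recurrences: ρ = r({ℓ}) in M, δ and δ' the coloop gaps of M and M',
    -- Tc, Td (resp. Sc, Sd) the values for the contractions and deletions.
    tutteRec : (ρ δ' δ : ℕ) → ℤ → ℤ → ℤ
    tutteRec ρ δ' δ Tc Td = (a ^ 0 * (b ^ (1 ∸ ρ) * z ^ 0)) * Tc Int.+ (a ^ δ' * (b ^ 0 * z ^ (δ ∸ δ'))) * Td

    activityRec : (ρ δ' δ : ℕ) → ℤ → ℤ → ℤ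
    activityRec ρ δ' δ Sc Sd = (x ^ δ' * (u ^ 0 * (y ^ 0 * (v ^ (1 ∸ ρ) * z ^ 0)))) * Sc
                         Int.+ (x ^ 0 * (u ^ δ' * (y ^ (1 ∸ ρ) * (v ^ 0 * z ^ (δ ∸ δ'))))) * Sd

    -- ℓ a loop (so δ = δ' = 0 and contraction = deletion): both sides are (y + v) T.
    loop-case : ∀ {ρ δ' δ Tc Td Sc Sd} → ρ ≡ 0 → δ' ≡ 0 → δ ≡ 0 → Tc ≡ Td → Tc ≡ Sc → Td ≡ Sd →
                tutteRec ρ δ' δ Tc Td ≡ activityRec ρ δ' δ Sc Sd
    loop-case {Tc = T} refl refl refl refl refl refl = identity y v T
      where
      identity : ∀ y v T → (1ℤ * ((((y Int.+ v) Int.- 1ℤ) * 1ℤ) * 1ℤ)) * T Int.+ (1ℤ * (1ℤ * 1ℤ)) * T ≡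
                           (1ℤ * (1ℤ * (1ℤ * ((v * 1ℤ) * 1ℤ)))) * T Int.+ (1ℤ * (1ℤ * ((y * 1ℤ) * (1ℤ * 1ℤ)))) * T
      identity = ℤSolver.solve-∀

    generic-case : ∀ {ρ δ' δ Tc Td Sc Sd} → ρ ≡ 1 → δ' ≡ 0 → Tc ≡ Sc → Td ≡ Sd →
                   tutteRec ρ δ' δ Tc Td ≡ activityRec ρ δ' δ Sc Sd
    generic-case {δ = δ} {Tc} {Td} refl refl refl refl = identity (z ^ δ) Tc Td
      where
      identity : ∀ Z Tc Td → (1ℤ * (1ℤ * 1ℤ)) * Tc Int.+ (1ℤ * (1ℤ * Z)) * Td ≡
                             (1ℤ * (1ℤ * (1ℤ * (1ℤ * 1ℤ)))) * Tc Int.+ (1ℤ * (1ℤ * (1ℤ * (1ℤ * Z)))) * Td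
      identity = ℤSolver.solve-∀

    -- ℓ a coloop of M' (so also of M, and contraction = deletion): both sides are (x + u) T.
    coloop-case : ∀ {ρ δ' δ Tc Td Sc Sd} → ρ ≡ 1 → δ' ≡ 1 → δ ≡ 1 → Tc ≡ Td → Tc ≡ Sc → Td ≡ Sd →
                  tutteRec ρ δ' δ Tc Td ≡ activityRec ρ δ' δ Sc Sd
    coloop-case {Tc = T} refl refl refl refl refl refl = identity x u T
      where
      identity : ∀ x u T → (1ℤ * (1ℤ * 1ℤ)) * T Int.+ ((((x Int.+ u) Int.- 1ℤ) * 1ℤ) * (1ℤ * 1ℤ)) * T ≡
                           ((x * 1ℤ) * (1ℤ * (1ℤ * (1ℤ * 1ℤ)))) * T Int.+ (1ℤ * ((u * 1ℤ) * (1ℤ * (1ℤ * 1ℤ)))) * T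
      identity = ℤSolver.solve-∀

  module Step (x u y v z : ℤ) {m : ℕ} (M M' : Matroid (suc m)) (q : Quotient M M') where
    open Expansion x u y v z
    module D = Minors M
    module D' = Minors M'
    open D using (ℓ; ρ; δ; ρ≤; ρ≤1)
    open D' using () renaming (ρ to ρ'; δ to δ'; ρ≤ to ρ'≤)

    Md Mc Md' Mc' : Matroid m
    Md = D.deletion
    Mc = D.contraction
    Md' = D'.deletion
    Mc' = D'.contraction

    deletion-quotient : Quotient Md Md'
    deletion-quotient X Y Y⊆X = q (X ∷ʳ outside) (Y ∷ʳ outside) (∷ʳ-⊆ outside Y⊆X)

    contraction-quotient : Quotient Mc Mc'
    contraction-quotient X Y Y⊆X =
      exchange-∸ (ρ≤ Y) (ρ≤ X) (ρ'≤ X) (ρ'≤ Y) (q (X ∷ʳ inside) (Y ∷ʳ inside) (∷ʳ-⊆ inside Y⊆X))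

    δ'≤δ : δ' ≤ δ
    δ'≤δ = offset-≤ {Rd = D.Rd} {Rd' = D'.Rd}
      (subst₂ _≤_ (cong (_+ D.Rd) D'.R≡Rd+δ) (cong (_+ D'.Rd) D.R≡Rd+δ) (q ⊤ (⊤ ∷ʳ outside) ⊆⊤))

    ρ'≤ρ : ρ' ≤ ρ
    ρ'≤ρ = subst₂ _≤_ (trans (cong (ρ' +_) (Ranks.r⊥≡0 M)) (NP.+-identityʳ _))
                      (trans (cong (ρ +_) (Ranks.r⊥≡0 M')) (NP.+-identityʳ _)) (q ⁅ ℓ ⁆ ⊥ ⊥⊆)

    cr-out : ∀ A → cr M' (A ∷ʳ outside) ≡ δ' + cr Md' A
    cr-out A = ∸-split (rank-mono M' _ _ (∷ʳ-⊆ outside ⊆⊤)) D'.Rd≤R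

    nl-out : ∀ A → nl M (A ∷ʳ outside) ≡ 0 + nl Md A
    nl-out A = cong (_∸ rank M (A ∷ʳ outside)) (trans (∣∷ʳ∣ A outside) (NP.+-identityʳ _))

    rcd-out : ∀ A → rcd M M' (A ∷ʳ outside) ≡ (δ ∸ δ') + rcd Md Md' A
    rcd-out A = ∸-offsets D.R≡Rd+δ D'.R≡Rd+δ δ'≤δ (deletion-quotient ⊤ A ⊆⊤)

    ε-out : ∀ A → ε M (A ∷ʳ outside) ≡ (1 ∸ ρ) + ε Md A
    ε-out A = trans (count-last (extActive? M (A ∷ʳ outside)))
      (trans (cong₂ _+_ (Transfer.ε-transfer M outside Md 0 D.deletion-shift A) (D.ext-ℓ-out A)) (NP.+-comm (ε Md A) (1 ∸ ρ)))

    ι-out : ∀ A → ι M' (A ∷ʳ outside) ≡ 0 + ι Md' A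
    ι-out A = trans (count-last (intActive? M' (A ∷ʳ outside)))
      (trans (cong₂ _+_ (Transfer.ι-transfer M' outside Md' 0 D'.deletion-shift A) (D'.int-ℓ-out A)) (NP.+-identityʳ _))

    cr-in : ∀ A → cr M' (A ∷ʳ inside) ≡ 0 + cr Mc' A
    cr-in A = trans (cong (_∸ rank M' (A ∷ʳ inside)) D'.R≡) (∸-shift _ (ρ'≤ A))

    nl-in : ∀ A → nl M (A ∷ʳ inside) ≡ (1 ∸ ρ) + nl Mc A
    nl-in A = trans (cong (_∸ rank M (A ∷ʳ inside)) (trans (∣∷ʳ∣ A inside) (NP.+-comm _ 1)))
                (nullity-split ρ≤1 (ρ≤ A) (NP.≤-trans (D.with-ℓ≤ A) (NP.+-monoʳ-≤ ρ (rank-card Md A))))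

    rcd-in : ∀ A → rcd M M' (A ∷ʳ inside) ≡ 0 + rcd Mc Mc' A
    rcd-in A = trans (cong₂ (λ s t → (s + rank M' (A ∷ʳ inside)) ∸ (t + rank M (A ∷ʳ inside))) D.R≡ D'.R≡)
                     (∸-shift₂ (ρ≤ ⊤) (ρ≤ A) (ρ'≤ ⊤) (ρ'≤ A))

    ε-in : ∀ A → ε M (A ∷ʳ inside) ≡ 0 + ε Mc A
    ε-in A = trans (count-last (extActive? M (A ∷ʳ inside)))
      (trans (cong₂ _+_ (Transfer.ε-transfer M inside Mc ρ D.contraction-shift A) (D.ext-ℓ-in A)) (NP.+-identityʳ _))

    ι-in : ∀ A → ι M' (A ∷ʳ inside) ≡ δ' + ι Mc' A
    ι-in A = trans (count-last (intActive? M' (A ∷ʳ inside)))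
      (trans (cong₂ _+_ (Transfer.ι-transfer M' inside Mc' ρ' D'.contraction-shift A) (D'.int-ℓ-in A)) (NP.+-comm (ι Mc' A) δ'))

    tutte-recurrence : tutte M M' (x Int.+ u) (y Int.+ v) z ≡
      tutteRec ρ δ' δ (tutte Mc Mc' (x Int.+ u) (y Int.+ v) z) (tutte Md Md' (x Int.+ u) (y Int.+ v) z)
    tutte-recurrence = sum-split m (tutteTerm M M') (tutteTerm Mc Mc') (tutteTerm Md Md')
      (a Int.^ 0 Int.* (b Int.^ (1 ∸ ρ) Int.* z Int.^ 0)) (a Int.^ δ' Int.* (b Int.^ 0 Int.* z Int.^ (δ ∸ δ')))
      (λ A → tutteTerm-split M M' Mc Mc' (A ∷ʳ inside) A 0 (1 ∸ ρ) 0 (cr-in A) (nl-in A) (rcd-in A))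
      (λ A → tutteTerm-split M M' Md Md' (A ∷ʳ outside) A δ' 0 (δ ∸ δ') (cr-out A) (nl-out A) (rcd-out A))

    activity-recurrence : activitySum M M' ≡ activityRec ρ δ' δ (activitySum Mc Mc') (activitySum Md Md')
    activity-recurrence = sum-split m (activityTerm M M') (activityTerm Mc Mc') (activityTerm Md Md')
      (x Int.^ δ' Int.* (u Int.^ 0 Int.* (y Int.^ 0 Int.* (v Int.^ (1 ∸ ρ) Int.* z Int.^ 0))))
      (x Int.^ 0 Int.* (u Int.^ δ' Int.* (y Int.^ (1 ∸ ρ) Int.* (v Int.^ 0 Int.* z Int.^ (δ ∸ δ')))))
      (λ A → activityTerm-split M M' Mc Mc' (A ∷ʳ inside) A δ' 0 0 (1 ∸ ρ) 0
               (ι-in A) (cr-in A) (ε-in A) (nl-in A) (rcd-in A))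
      (λ A → activityTerm-split M M' Md Md' (A ∷ʳ outside) A 0 δ' (1 ∸ ρ) 0 (δ ∸ δ')
               (ι-out A) (cr-out A) (ε-out A) (nl-out A) (rcd-out A))

    step : tutte Mc Mc' (x Int.+ u) (y Int.+ v) z ≡ activitySum Mc Mc' →
           tutte Md Md' (x Int.+ u) (y Int.+ v) z ≡ activitySum Md Md' →
           tutte M M' (x Int.+ u) (y Int.+ v) z ≡ activitySum M M'
    step IHc IHd = trans tutte-recurrence (trans recurrences-agree (sym activity-recurrence))
      where
      recurrences-agree : tutteRec ρ δ' δ (tutte Mc Mc' (x Int.+ u) (y Int.+ v) z) (tutte Md Md' (x Int.+ u) (y Int.+ v) z)
                        ≡ activityRec ρ δ' δ (activitySum Mc Mc') (activitySum Md Md')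
      recurrences-agree with D.loop-or-not | D'.coloop-or-not
      ... | inj₁ ρ≡0 | _ = loop-case ρ≡0 δ'≡0 δ≡0
              (tutte-cong {N₁ = Mc} {Md} {Mc'} {Md'} (D.loop⇒contraction≗deletion ρ≡0) (D'.loop⇒contraction≗deletion ρ'≡0)) IHc IHd
        where
        δ≡0 : δ ≡ 0
        δ≡0 = D.loop⇒δ≡0 ρ≡0
        δ'≡0 : δ' ≡ 0
        δ'≡0 = NP.n≤0⇒n≡0 (subst (δ' ≤_) δ≡0 δ'≤δ)
        ρ'≡0 : ρ' ≡ 0
        ρ'≡0 = NP.n≤0⇒n≡0 (subst (ρ' ≤_) ρ≡0 ρ'≤ρ)
      ... | inj₂ ρ≡1 | inj₁ δ'≡0 = generic-case ρ≡1 δ'≡0 IHc IHd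
      ... | inj₂ ρ≡1 | inj₂ δ'≡1 = coloop-case ρ≡1 δ'≡1 δ≡1
              (tutte-cong {N₁ = Mc} {Md} {Mc'} {Md'} (D.coloop⇒contraction≗deletion δ≡1) (D'.coloop⇒contraction≗deletion δ'≡1)) IHc IHd
        where
        δ≡1 : δ ≡ 1
        δ≡1 = NP.≤-antisym D.δ≤1 (subst (_≤ δ) δ'≡1 δ'≤δ)

  -- The theorem for quotients, by induction on n.  For n = 0 both sides are the single
  -- term of A = ∅, which is 1 because the ranks of ∅ vanish.
  expansion : ∀ n (M M' : Matroid n) → Quotient M M' → ∀ x u y v z →
              tutte M M' (x Int.+ u) (y Int.+ v) z ≡ Expansion.activitySum x u y v z M M'
  expansion zero M M' _ x u y v z with rank M [] | rank-card M [] | rank M' [] | rank-card M' []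
  ... | .0 | ℕ.z≤n | .0 | ℕ.z≤n = refl
  expansion (suc m) M M' q x u y v z =
    S.step (expansion m S.Mc S.Mc' S.contraction-quotient x u y v z)
           (expansion m S.Md S.Md' S.deletion-quotient x u y v z)
    where module S = Step x u y v z M M' q

open import Data.Nat using (ℕ)
open import Data.Integer using (ℤ; _+_; _*_; _^_)
open import Relation.Binary.PropositionalEquality using (_≡_)

theorem4 : (n : ℕ) (M M' : Matroid n) → Perspective M M' →
    (x u y v z : ℤ) →
    tutte M M' (x + u) (y + v) z ≡
    sumSubsets n (λ A → (x ^ ι M' A) * ((u ^ cr M' A) * ((y ^ ε M A) * ((v ^ nl M A) * (z ^ rcd M M' A)))))
theorem4 n M M' P = Proof.expansion n M M' (Proof.perspective⇒quotient M M' P)
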